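{- Let $d$ and $k$ be positive integers with $k\le d$. The number of $312$-avoiding affine permutations $\pi\in\widetilde{\mathfrak S}_d$ that have exactly $k$ cut points modulo $d$ is $$\binom{2d-k-1}{d-1}.$$
   Context: An affine permutation $\pi\in\widetilde{\mathfrak S}_d$ is a bijection $\pi:\mathbb Z\to\mathbb Z$ such that $\pi(i+d)=\pi(i)+d$ for all $i\in\mathbb Z$ and $\sum_{i=0}^{d-1}(\pi(i)-i)=0$. It is $312$-avoiding if there are no integers $i<j<k$ with $\pi(j)<\pi(k)<\pi(i)$. A cut point of $\pi$ is an integer $j$ such that $\pi(i)<\pi(k)$ for all integers $i\le j<k$. If $j$ is a cut point then so is every integer congruent to $j$ modulo $d$; "the number of cut points modulo $d$" means the number of residue classes modulo $d$ consisting of cut points. -}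

module Defs where

open import Data.Nat using (ℕ)
open import Data.Empty using (⊥)
open import Data.Integer using (ℤ; +_; _+_; _-_; _<_; _≤_; 0ℤ)
open import Data.Fin using (Fin; toℕ)
open import Data.Fin.Subset using (Subset; _∈_; ∣_∣)
open import Data.List using (List; foldr; map; allFin)
open import Data.Product using (_×_; Σ)
open import Data.Vec using (Vec; lookup)
open import Function.Bundles using (_⇔_)
open import Function.Definitions using (Bijective)
open import Relation.Binary.PropositionalEquality using (_≡_)

toℤ : {d : ℕ} → Fin d → ℤ
toℤ r = + (toℕ r)

sumℤ : List ℤ → ℤ
sumℤ = foldr _+_ 0ℤ

record IsAffinePerm (d : ℕ) (π : ℤ → ℤ) : Set where
  field
    bijective : Bijective _≡_ _≡_ π
    periodic  : ∀ i → π (i + + d) ≡ π i + + d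
    balanced  : sumℤ (map (λ (r : Fin d) → π (toℤ r) - toℤ r) (allFin d)) ≡ 0ℤ

Avoids312 : (ℤ → ℤ) → Set
Avoids312 π = ∀ i j k → i < j → j < k → π j < π k → π k < π i → ⊥

IsCutPoint : (ℤ → ℤ) → ℤ → Set
IsCutPoint π j = ∀ i k → i ≤ j → j < k → π i < π k

-- exactly k residue classes mod d consist of cut points
-- (the residue class of r ∈ {0,…,d-1} is represented by r itself)
HasCutPointsMod : (d : ℕ) → (ℤ → ℤ) → ℕ → Set
HasCutPointsMod d π k =
  Σ (Subset d) λ S → (∣ S ∣ ≡ k) × (∀ r → (r ∈ S) ⇔ IsCutPoint π (toℤ r))

GoodWindow : (d k : ℕ) → Vec ℤ d → Set
GoodWindow d k w =
  Σ (ℤ → ℤ) λ π → (∀ r → π (toℤ r) ≡ lookup w r)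
    × IsAffinePerm d π × Avoids312 π × HasCutPointsMod d π k

module Submission where

-- Write k = b + 1 and d = b + m + 1.  We set up an explicit bijection
-- between these windows and "shapes" (t , o , v): a binary tree t with a
-- mark 0 ≤ o ≤ size t and a vector v of b further trees, of total size m.
--   * A binary tree T of size n encodes a 312-avoiding permutation perm T of
--     {0,…,n-1}, every such permutation arises from a unique tree, and the
--     cut points of perm T are the positions on its right spine
--     (TreePermutations, FiniteMaps, TreeDecomposition).
--   * Shapes of size m are enumerated by Pascal's rule; there are
--     C(2m+b, m) of them (Shapes).
--   * Cutting ℤ into blocks -o + [qd, qd + d), an affine permutation with a
--     cut point at -o-1 maps every block to itself through one pattern, and
--     conversely such block maps are balanced affine permutations
--     (IntegerSums, BlockMaps, Normalisation).
--   * The shape (t , o , v) gives the block map with base -o and pattern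
--     perm (node t (comb v)); its cut points modulo d correspond to the
--     b + 1 spine nodes.  Every good window arises this way (taking o from
--     the largest cut residue), and from exactly one shape (Counting,
--     RightSpine, Windows).

import Data.Nat.Base as Nat

-- Binary trees, with nodes numbered in order (left subtree, root, right
-- subtree), and the 312-avoiding permutations they encode.
module TreePermutations where
  open import Data.Nat
  open import Data.Nat.Properties
  open import Data.Bool using (Bool; true; false)
  open import Data.Empty using (⊥; ⊥-elim)
  open import Relation.Binary.PropositionalEquality

  data Tree : Set where
    leaf : Tree
    node : Tree → Tree → Tree

  size : Tree → ℕ
  size leaf = 0
  size (node a b) = suc (size a + size b)

  data Side (a : ℕ) : ℕ → Set where
    inLeft  : ∀ {i} → i < a → Side a i
    atRoot  : Side a a
    inRight : ∀ j → Side a (suc (a + j))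

  side : ∀ a i → Side a i
  side zero    zero    = atRoot
  side zero    (suc i) = inRight i
  side (suc a) zero    = inLeft z<s
  side (suc a) (suc i) with side a i
  ... | inLeft p  = inLeft (s<s p)
  ... | atRoot    = atRoot
  ... | inRight j = inRight j

  -- It is computed by the library's compare, so that proofs analysing a
  -- position with side can still rewrite with the computation rules below.
  bySide : {A : Set} → ℕ → ℕ → (ℕ → A) → A → (ℕ → A) → A
  bySide a i l m r with compare i a
  ... | less _ _    = l i
  ... | equal _     = m
  ... | greater _ j = r j

  right≢root : ∀ a j → a ≢ suc (a + j)
  right≢root a j = m≢1+m+n a

  right≰root : ∀ a j → suc (a + j) ≤ a → ⊥
  right≰root a j p = 1+n≰n (≤-trans (s≤s (m≤m+n a j)) p)

  right≮root : ∀ a j → suc (a + j) < a → ⊥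
  right≮root a j p = right≰root a j (<⇒≤ p)

  right-<⁺ : ∀ a {j j'} → j < j' → suc (a + j) < suc (a + j')
  right-<⁺ a p = s≤s (+-monoʳ-< a p)

  right-<⁻ : ∀ a {j j'} → suc (a + j) < suc (a + j') → j < j'
  right-<⁻ a p = +-cancelˡ-< a _ _ (≤-pred p)

  right-injective : ∀ a {j j'} → suc (a + j) ≡ suc (a + j') → j ≡ j'
  right-injective a e = +-cancelˡ-≡ a _ _ (suc-injective e)

  module _ {A : Set} (a : ℕ) (l : ℕ → A) (m : A) (r : ℕ → A) where
    bySide-left : ∀ {i} → i < a → bySide a i l m r ≡ l i
    bySide-left {i} p with compare i a
    ... | less _ _    = refl
    ... | equal _     = ⊥-elim (<-irrefl refl p)
    ... | greater _ j = ⊥-elim (right≮root a j p)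

    -- (stated for any i equal to a, since the index a cannot be matched on)
    bySide-root′ : ∀ i → i ≡ a → bySide a i l m r ≡ m
    bySide-root′ i e with compare i a
    ... | less _ k    = ⊥-elim (right≢root i k e)
    ... | equal _     = refl
    ... | greater _ j = ⊥-elim (right≢root a j (sym e))

    bySide-root : bySide a a l m r ≡ m
    bySide-root = bySide-root′ a refl

    bySide-right′ : ∀ i j → i ≡ suc (a + j) → bySide a i l m r ≡ r j
    bySide-right′ i j e with compare i a
    ... | less _ k     = ⊥-elim (right≮root a j (subst (_< suc (i + k)) e (s≤s (m≤m+n i k))))
    ... | equal _      = ⊥-elim (right≢root a j e)
    ... | greater _ j' = cong r (right-injective a e)

    bySide-right : ∀ j → bySide a (suc (a + j)) l m r ≡ r j
    bySide-right j = bySide-right′ _ j refl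

  perm : Tree → ℕ → ℕ
  perm leaf       i = 0
  perm (node a b) i =
    bySide (size a) i (λ i → suc (perm a i)) 0 (λ j → suc (size a + perm b j))

  -- The positions of the right spine (the root, the root of the right
  -- subtree, …); they will turn out to be exactly the cut points of perm T.
  onSpine : Tree → ℕ → Bool
  onSpine leaf       i = false
  onSpine (node a b) i = bySide (size a) i (λ _ → false) true (onSpine b)

  perm-left : ∀ a b i → i < size a → perm (node a b) i ≡ suc (perm a i)
  perm-left a b i = bySide-left (size a) _ _ _

  perm-root : ∀ a b → perm (node a b) (size a) ≡ 0
  perm-root a b = bySide-root (size a) _ _ _

  perm-right : ∀ a b j → perm (node a b) (suc (size a + j)) ≡ suc (size a + perm b j)
  perm-right a b = bySide-right (size a) _ _ _

  onSpine-left : ∀ a b i → i < size a → onSpine (node a b) i ≡ false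
  onSpine-left a b i = bySide-left (size a) _ _ _

  onSpine-root : ∀ a b → onSpine (node a b) (size a) ≡ true
  onSpine-root a b = bySide-root (size a) _ _ _

  onSpine-right : ∀ a b j → onSpine (node a b) (suc (size a + j)) ≡ onSpine b j
  onSpine-right a b = bySide-right (size a) _ _ _

  MapsInto : (ℕ → ℕ) → ℕ → Set
  MapsInto f n = ∀ i → i < n → f i < n

  InjectiveBelow : (ℕ → ℕ) → ℕ → Set
  InjectiveBelow f n = ∀ i j → i < n → j < n → f i ≡ f j → i ≡ j

  Avoids312Below : (ℕ → ℕ) → ℕ → Set
  Avoids312Below f n = ∀ i j k → i < j → j < k → k < n → f j < f k → f k < f i → ⊥

  CutBelow : (ℕ → ℕ) → ℕ → ℕ → Set
  CutBelow f n r = ∀ i j → i ≤ r → r < j → j < n → f i < f j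

  perm-into : ∀ T → MapsInto (perm T) (size T)
  perm-into leaf i ()
  perm-into (node a b) i p with side (size a) i
  ... | inLeft q  rewrite perm-left a b i q = s≤s (≤-trans (perm-into a i q) (m≤m+n _ _))
  ... | atRoot    rewrite perm-root a b     = z<s
  ... | inRight j rewrite perm-right a b j  =
    s≤s (+-monoʳ-< (size a) (perm-into b j (right-<⁻ (size a) p)))

  perm-left≤ : ∀ a b i → i ≤ size a → perm (node a b) i ≤ size a
  perm-left≤ a b i p with side (size a) i
  ... | inLeft q  rewrite perm-left a b i q = perm-into a i q
  ... | atRoot    rewrite perm-root a b     = z≤n
  ... | inRight j = ⊥-elim (right≰root _ j p)

  perm-right> : ∀ a b i → size a < i → size a < perm (node a b) i
  perm-right> a b i p with side (size a) i
  ... | inLeft q  = ⊥-elim (<-asym p q)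
  ... | atRoot    = ⊥-elim (<-irrefl refl p)
  ... | inRight j rewrite perm-right a b j = s≤s (m≤m+n _ _)

  perm-zero⇒root : ∀ a b i → perm (node a b) i ≡ 0 → i ≡ size a
  perm-zero⇒root a b i z with side (size a) i
  ... | inLeft p  = ⊥-elim (1+n≢0 (trans (sym (perm-left a b i p)) z))
  ... | atRoot    = refl
  ... | inRight j = ⊥-elim (1+n≢0 (trans (sym (perm-right a b j)) z))

  perm-injective : ∀ T → InjectiveBelow (perm T) (size T)
  perm-injective leaf i j () _ _
  perm-injective (node a b) i j p q e with side (size a) i | side (size a) j
  ... | atRoot | _ = sym (perm-zero⇒root a b j (trans (sym e) (perm-root a b)))
  ... | _ | atRoot = perm-zero⇒root a b i (trans e (perm-root a b))
  ... | inLeft pi | inLeft pj = perm-injective a i j pi pj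
        (suc-injective (trans (sym (perm-left a b i pi)) (trans e (perm-left a b j pj))))
  ... | inRight i' | inRight j' = cong (λ x → suc (size a + x))
        (perm-injective b i' j' (right-<⁻ (size a) p) (right-<⁻ (size a) q)
          (right-injective (size a) (trans (sym (perm-right a b i')) (trans e (perm-right a b j')))))
  ... | inLeft pi | inRight j' =
    ⊥-elim (<-irrefl e (≤-<-trans (perm-left≤ a b i (<⇒≤ pi)) (perm-right> a b _ (s≤s (m≤m+n _ j')))))
  ... | inRight i' | inLeft pj =
    ⊥-elim (<-irrefl (sym e) (≤-<-trans (perm-left≤ a b j (<⇒≤ pj)) (perm-right> a b _ (s≤s (m≤m+n _ i')))))

  -- perm T avoids 312: a pattern cannot use the root (value 0 would have to be
  -- its largest or middle entry), cannot straddle the root (left values are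
  -- smaller than right ones), so it lies inside one subtree.
  perm-avoids312 : ∀ T → Avoids312Below (perm T) (size T)
  perm-avoids312 leaf i j k _ _ () _ _
  perm-avoids312 (node a b) i j k ij jk kn fjk fki with side (size a) i | side (size a) k
  ... | inLeft pi | inLeft pk = let pj = <-trans jk pk in
    perm-avoids312 a i j k ij jk pk
      (≤-pred (subst₂ _<_ (perm-left a b j pj) (perm-left a b k pk) fjk))
      (≤-pred (subst₂ _<_ (perm-left a b k pk) (perm-left a b i pi) fki))
  ... | inLeft pi | atRoot = n≮0 (subst (perm (node a b) j <_) (perm-root a b) fjk)
  ... | inLeft pi | inRight k' =
    <-asym fki (≤-<-trans (perm-left≤ a b i (<⇒≤ pi)) (perm-right> a b _ (s≤s (m≤m+n _ k'))))
  ... | atRoot | _ = n≮0 (subst (perm (node a b) k <_) (perm-root a b) fki)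
  ... | inRight i' | inLeft pk = right≮root _ i' (<-trans (<-trans ij jk) pk)
  ... | inRight i' | atRoot = right≮root _ i' (<-trans ij jk)
  ... | inRight i' | inRight k' with side (size a) j
  ...   | inLeft pj = right≮root _ i' (<-trans ij pj)
  ...   | atRoot = right≮root _ i' ij
  ...   | inRight j' = perm-avoids312 b i' j' k'
          (right-<⁻ _ ij) (right-<⁻ _ jk) (right-<⁻ (size a) kn)
          (+-cancelˡ-< (size a) _ _ (≤-pred (subst₂ _<_ (perm-right a b j') (perm-right a b k') fjk)))
          (+-cancelˡ-< (size a) _ _ (≤-pred (subst₂ _<_ (perm-right a b k') (perm-right a b i') fki)))

  spine⇒cut : ∀ T r → onSpine T r ≡ true → CutBelow (perm T) (size T) r
  spine⇒cut leaf r ()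
  spine⇒cut (node a b) r e i j ir rj jn with side (size a) r
  ... | inLeft p rewrite onSpine-left a b r p = ⊥-elim (false≢true e)
    where false≢true : false ≢ true
          false≢true ()
  ... | atRoot = ≤-<-trans (perm-left≤ a b i ir) (perm-right> a b j rj)
  ... | inRight r' with side (size a) j
  ...   | inLeft q = ⊥-elim (right≮root _ r' (<-trans rj q))
  ...   | atRoot = ⊥-elim (right≮root _ r' rj)
  ...   | inRight j' with side (size a) i
  ...     | inLeft q = ≤-<-trans (perm-left≤ a b i (<⇒≤ q)) (perm-right> a b _ (s≤s (m≤m+n _ j')))
  ...     | atRoot = ≤-<-trans (perm-left≤ a b i ≤-refl) (perm-right> a b _ (s≤s (m≤m+n _ j')))
  ...     | inRight i' = subst₂ _<_ (sym (perm-right a b i')) (sym (perm-right a b j'))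
                      (s≤s (+-monoʳ-< (size a)
                        (spine⇒cut b r' (trans (sym (onSpine-right a b r')) e) i' j'
                          (+-cancelˡ-≤ (size a) _ _ (≤-pred ir)) (right-<⁻ _ rj) (right-<⁻ (size a) jn))))

  cut⇒spine : ∀ T r → r < size T → CutBelow (perm T) (size T) r → onSpine T r ≡ true
  cut⇒spine leaf r () _
  cut⇒spine (node a b) r rn cut with side (size a) r
  ... | inLeft p = ⊥-elim (n≮0 (subst (perm (node a b) r <_) (perm-root a b)
                     (cut r (size a) ≤-refl p (s≤s (m≤m+n _ _)))))
  ... | atRoot = onSpine-root a b
  ... | inRight r' = trans (onSpine-right a b r') (cut⇒spine b r' (right-<⁻ (size a) rn) cutᵇ)
    where
    cutᵇ : CutBelow (perm b) (size b) r'
    cutᵇ i j ir rj jn = +-cancelˡ-< (size a) _ _ (≤-pred (subst₂ _<_ (perm-right a b i) (perm-right a b j)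
      (cut (suc (size a + i)) (suc (size a + j)) (s≤s (+-monoʳ-≤ (size a) ir))
           (right-<⁺ _ rj) (right-<⁺ _ jn))))

  perm-determines : ∀ T₁ T₂ → size T₁ ≡ size T₂ → (∀ i → i < size T₁ → perm T₁ i ≡ perm T₂ i) → T₁ ≡ T₂
  perm-determines leaf leaf _ _ = refl
  perm-determines (node a b) (node a' b') s h with perm-determines a a' same-root same-left
    where
    root<size : size a < size (node a b)
    root<size = s≤s (m≤m+n _ _)
    same-root : size a ≡ size a'
    same-root = perm-zero⇒root a' b' (size a) (trans (sym (h (size a) root<size)) (perm-root a b))
    same-left : ∀ i → i < size a → perm a i ≡ perm a' i
    same-left i p = suc-injective (trans (sym (perm-left a b i p))
      (trans (h i (<-trans p root<size)) (perm-left a' b' i (subst (i <_) same-root p))))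
  ... | refl = cong (node a) (perm-determines b b' (right-injective (size a) s) same-right)
    where
    same-right : ∀ j → j < size b → perm b j ≡ perm b' j
    same-right j p = right-injective (size a) (trans (sym (perm-right a b j))
      (trans (h (suc (size a + j)) (right-<⁺ _ p)) (perm-right a b' j)))

-- Maps on initial segments {0,…,n-1} of ℕ, transported to Fin n so that the
-- library's pigeonhole principle and permutations apply.
module FiniteMaps where
  open import Data.Nat
  open import Data.Nat.Properties
  open import Data.Fin using (Fin; toℕ; fromℕ<; punchOut)
  open import Data.Fin.Properties using (toℕ<n; toℕ-fromℕ<; toℕ-injective; injective⇒≤; any?; punchOut-injective)
  open import Data.Fin.Permutation using (Permutation; permutation)
  open import Data.Product using (Σ; _×_; _,_; proj₁; proj₂)
  open import Data.Empty using (⊥-elim)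
  open import Relation.Nullary using (yes; no)
  open import Relation.Binary.PropositionalEquality
  open TreePermutations using (MapsInto; InjectiveBelow)

  restrict : (f : ℕ → ℕ) (n m : ℕ) → (∀ i → i < n → f i < m) → Fin n → Fin m
  restrict f n m into i = fromℕ< (into (toℕ i) (toℕ<n i))

  toℕ-restrict : (f : ℕ → ℕ) (n m : ℕ) (into : ∀ i → i < n → f i < m) (i : Fin n) → toℕ (restrict f n m into i) ≡ f (toℕ i)
  toℕ-restrict f n m into i = toℕ-fromℕ< (into (toℕ i) (toℕ<n i))

  restrict-injective : (f : ℕ → ℕ) (n m : ℕ) (into : ∀ i → i < n → f i < m) → InjectiveBelow f n → ∀ {i j} →
                       restrict f n m into i ≡ restrict f n m into j → i ≡ j
  restrict-injective f n m into inj {i} {j} e = toℕ-injective (inj _ _ (toℕ<n i) (toℕ<n j)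
    (trans (sym (toℕ-restrict f n m into i)) (trans (cong toℕ e) (toℕ-restrict f n m into j))))

  pigeonhole : (f : ℕ → ℕ) (n m : ℕ) → InjectiveBelow f n → (∀ i → i < n → f i < m) → n ≤ m
  pigeonhole f n m inj into = injective⇒≤ {f = restrict f n m into} (restrict-injective f n m into inj)

  pigeonhole-interval : (g : ℕ → ℕ) (n lo hi : ℕ) → lo ≤ hi → InjectiveBelow g n →
    (∀ i → i < n → lo ≤ g i) → (∀ i → i < n → g i < hi) → n + lo ≤ hi
  pigeonhole-interval g n lo hi lo≤hi inj lb ub =
    subst (n + lo ≤_) (m∸n+n≡m lo≤hi) (+-monoˡ-≤ lo (pigeonhole (λ i → g i ∸ lo) n (hi ∸ lo) shifted-inj shifted-into))
    where
    shifted-inj : InjectiveBelow (λ i → g i ∸ lo) n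
    shifted-inj i j p q e = inj i j p q
      (trans (sym (m∸n+n≡m (lb i p))) (trans (cong (_+ lo) e) (m∸n+n≡m (lb j q))))
    shifted-into : ∀ i → i < n → g i ∸ lo < hi ∸ lo
    shifted-into i p = ∸-monoˡ-< (ub i p) (lb i p)

  -- An injective self-map of {0,…,n-1} is onto: otherwise, punching out a
  -- missed value y would give an injection of n points into n - 1.
  surjective : (f : ℕ → ℕ) (n : ℕ) → InjectiveBelow f n → MapsInto f n → ∀ y → y < n → Σ ℕ λ i → i < n × f i ≡ y
  surjective f (suc n) inj into y y<n with any? (λ i → restrict f (suc n) (suc n) into i Data.Fin.≟ fromℕ< y<n)
  ... | yes (i , e) = toℕ i , toℕ<n i ,
          trans (sym (toℕ-restrict f _ _ into i)) (trans (cong toℕ e) (toℕ-fromℕ< y<n))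
  ... | no missed = ⊥-elim (1+n≰n (injective⇒≤ {f = punched} punched-injective))
    where
    F : Fin (suc n) → Fin (suc n)
    F = restrict f (suc n) (suc n) into
    avoids : ∀ i → fromℕ< y<n ≢ F i
    avoids i e = missed (i , sym e)
    punched : Fin (suc n) → Fin n
    punched i = punchOut (avoids i)
    punched-injective : ∀ {i j} → punched i ≡ punched j → i ≡ j
    punched-injective e = restrict-injective f (suc n) (suc n) into inj (punchOut-injective (avoids _) (avoids _) e)

  asPermutation : (f : ℕ → ℕ) (n : ℕ) → InjectiveBelow f n → MapsInto f n → Permutation n n
  asPermutation f n inj into = permutation F F⁻¹ F∘F⁻¹ F⁻¹∘F
    where
    F : Fin n → Fin n
    F = restrict f n n into
    F⁻¹ : Fin n → Fin n
    F⁻¹ y = fromℕ< (proj₁ (proj₂ (surjective f n inj into (toℕ y) (toℕ<n y))))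
    F∘F⁻¹ : ∀ y → F (F⁻¹ y) ≡ y
    F∘F⁻¹ y with surjective f n inj into (toℕ y) (toℕ<n y)
    ... | i , i<n , fi≡y = toℕ-injective (trans (toℕ-restrict f n n into (fromℕ< i<n))
                              (trans (cong f (toℕ-fromℕ< i<n)) fi≡y))
    F⁻¹∘F : ∀ x → F⁻¹ (F x) ≡ x
    F⁻¹∘F x = restrict-injective f n n into inj (F∘F⁻¹ (F x))

-- Every injective 312-avoiding self-map of {0,…,n-1} is the permutation of a
-- binary tree: the position p of the value 0 becomes the root, the values
-- left of p are exactly 1,…,p and those right of p are exactly p+1,…,n-1,
-- and both parts are again 312-avoiding.
module TreeDecomposition where
  open import Data.Nat
  open import Data.Nat.Properties
  open import Data.Nat.Induction using (<-rec)
  open import Data.Product using (Σ; _×_; _,_)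
  open import Data.Empty using (⊥-elim)
  open import Relation.Binary using (tri<; tri≈; tri>)
  open import Relation.Binary.PropositionalEquality
  open TreePermutations
  open FiniteMaps using (pigeonhole-interval; surjective)

  TreeOf : (ℕ → ℕ) → ℕ → Set
  TreeOf f n = Σ Tree λ T → size T ≡ n × (∀ i → i < n → f i ≡ perm T i)

  ∸-<⁻ : ∀ {a b} c → a ∸ c < b ∸ c → a < b
  ∸-<⁻ {a} {b} c p = ≰⇒> (λ b≤a → <-irrefl refl (<-≤-trans p (∸-monoˡ-≤ c b≤a)))

  ∸-injective : ∀ {a b c} → c ≤ a → c ≤ b → a ∸ c ≡ b ∸ c → a ≡ b
  ∸-injective {c = c} c≤a c≤b e = trans (sym (m∸n+n≡m c≤a)) (trans (cong (_+ c) e) (m∸n+n≡m c≤b))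

  module RootSplit (f : ℕ → ℕ) (n : ℕ) (inj : InjectiveBelow f n) (into : MapsInto f n)
                   (av : Avoids312Below f n) (p : ℕ) (p<n : p < n) (fp≡0 : f p ≡ 0) where
    r : ℕ
    r = n ∸ suc p

    p+r : suc (p + r) ≡ n
    p+r = m+[n∸m]≡n p<n

    right-pos : ∀ j → j < r → suc (p + j) < n
    right-pos j j<r = subst (suc (p + j) <_) p+r (right-<⁺ p j<r)

    positive : ∀ k → k < n → k ≢ p → 1 ≤ f k
    positive k k<n k≢p = ≤∧≢⇒< z≤n (λ e → k≢p (inj k p k<n p<n (trans (sym e) (sym fp≡0))))

    -- Since f p = 0, a value on the left exceeding one on the right would
    -- complete a 312 pattern.
    left<right : ∀ i k → i < p → p < k → k < n → f i < f k
    left<right i k i<p p<k k<n with <-cmp (f i) (f k)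
    ... | tri< lt _ _ = lt
    ... | tri≈ _ eq _ = ⊥-elim (<-irrefl (inj i k (<-trans i<p (<-trans p<k k<n)) k<n eq) (<-trans i<p p<k))
    ... | tri> _ _ gt = ⊥-elim (av i p k i<p p<k k<n
            (subst (_< f k) (sym fp≡0) (positive k k<n (λ e → <-irrefl (sym e) p<k))) gt)

    -- The r right values lie in (f i, n), so f i ≤ p for every left i.
    left-bound : ∀ i → i < p → f i ≤ p
    left-bound i i<p = ≮⇒≥ λ p<fi → 1+n≰n (≤-trans (too-many p<fi) room)
      where
      room : r + suc (f i) ≤ suc (p + r)
      room = subst (r + suc (f i) ≤_) (sym p+r)
        (pigeonhole-interval (λ j → f (suc (p + j))) r (suc (f i)) n (into i (<-trans i<p p<n))
          (λ j j' a b e → right-injective p (inj _ _ (right-pos j a) (right-pos j' b) e))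
          (λ j a → left<right i (suc (p + j)) i<p (s≤s (m≤m+n p j)) (right-pos j a))
          (λ j a → into _ (right-pos j a)))
      too-many : p < f i → suc (suc (p + r)) ≤ r + suc (f i)
      too-many p<fi = subst (_≤ r + suc (f i)) shuffle (+-monoʳ-≤ r (s≤s p<fi))
        where
        shuffle : r + suc (suc p) ≡ suc (suc (p + r))
        shuffle = trans (+-suc r (suc p)) (cong suc (trans (+-suc r p) (cong suc (+-comm r p))))

    -- The p left values lie in [1, f k), so f k > p for every right k.
    right-bound : ∀ k → p < k → k < n → suc p ≤ f k
    right-bound k p<k k<n = ≮⇒≥ λ fk≤p → 1+n≰n (≤-trans
      (subst (_≤ f k) (+-comm p 1)
        (pigeonhole-interval f p 1 (f k) (positive k k<n (λ e → <-irrefl (sym e) p<k))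
          (λ i j a b e → inj i j (<-trans a p<n) (<-trans b p<n) e)
          (λ i a → positive i (<-trans a p<n) (λ e → <-irrefl e a))
          (λ i a → left<right i k a p<k k<n)))
      (≤-pred fk≤p))

    leftPart : ℕ → ℕ
    leftPart i = f i ∸ 1

    rightPart : ℕ → ℕ
    rightPart j = f (suc (p + j)) ∸ suc p

    left-positive : ∀ i → i < p → 1 ≤ f i
    left-positive i i<p = positive i (<-trans i<p p<n) (λ e → <-irrefl e i<p)

    right-above : ∀ j → j < r → suc p ≤ f (suc (p + j))
    right-above j j<r = right-bound _ (s≤s (m≤m+n p j)) (right-pos j j<r)

    leftPart-injective : InjectiveBelow leftPart p
    leftPart-injective i j a b e =
      inj i j (<-trans a p<n) (<-trans b p<n) (∸-injective (left-positive i a) (left-positive j b) e)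

    leftPart-into : MapsInto leftPart p
    leftPart-into i a = ∸-monoˡ-< (s≤s (left-bound i a)) (left-positive i a)

    leftPart-avoids : Avoids312Below leftPart p
    leftPart-avoids i j k ij jk k<p a b = av i j k ij jk (<-trans k<p p<n) (∸-<⁻ 1 a) (∸-<⁻ 1 b)

    rightPart-injective : InjectiveBelow rightPart r
    rightPart-injective i j a b e = right-injective p
      (inj _ _ (right-pos i a) (right-pos j b) (∸-injective (right-above i a) (right-above j b) e))

    rightPart-into : MapsInto rightPart r
    rightPart-into j a = ∸-monoˡ-< (into _ (right-pos j a)) (right-above j a)

    rightPart-avoids : Avoids312Below rightPart r
    rightPart-avoids i j k ij jk k<r a b =
      av _ _ _ (right-<⁺ p ij) (right-<⁺ p jk) (right-pos k k<r) (∸-<⁻ (suc p) a) (∸-<⁻ (suc p) b)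

    assemble : TreeOf leftPart p → TreeOf rightPart r → TreeOf f n
    assemble (a , refl , agreeˡ) (b , size-b , agreeʳ) = node a b , size-ab , agree
      where
      open ≡-Reasoning
      size-ab : size (node a b) ≡ n
      size-ab = trans (cong (λ x → suc (size a + x)) size-b) p+r
      agree : ∀ i → i < n → f i ≡ perm (node a b) i
      agree i i<n with side (size a) i
      ... | inLeft i<p = begin
          f i                   ≡⟨ m+[n∸m]≡n (left-positive i i<p) ⟨
          suc (leftPart i)      ≡⟨ cong suc (agreeˡ i i<p) ⟩
          suc (perm a i)        ≡⟨ perm-left a b i i<p ⟨
          perm (node a b) i     ∎
      ... | atRoot = trans fp≡0 (sym (perm-root a b))
      ... | inRight j = begin
          f (suc (size a + j))            ≡⟨ m+[n∸m]≡n (right-above j j<r) ⟨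
          suc (size a + rightPart j)      ≡⟨ cong (λ x → suc (size a + x)) (agreeʳ j j<r) ⟩
          suc (size a + perm b j)         ≡⟨ perm-right a b j ⟨
          perm (node a b) (suc (size a + j)) ∎
        where
        j<r : j < r
        j<r = subst (j <_) size-b (right-<⁻ (size a) (subst (suc (size a + j) <_) (sym size-ab) i<n))

  decompose : ∀ n f → InjectiveBelow f n → MapsInto f n → Avoids312Below f n → TreeOf f n
  decompose = <-rec _ step
    where
    step : ∀ n → (∀ {m} → m < n → ∀ f → InjectiveBelow f m → MapsInto f m → Avoids312Below f m → TreeOf f m) →
           ∀ f → InjectiveBelow f n → MapsInto f n → Avoids312Below f n → TreeOf f n
    step zero _ f _ _ _ = leaf , refl , λ _ ()
    step (suc n) rec f inj into av with surjective f (suc n) inj into 0 z<s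
    ... | p , p<n , fp≡0 =
      assemble (rec p<n leftPart leftPart-injective leftPart-into leftPart-avoids)
               (rec (s≤s (m∸n≤m n p)) rightPart rightPart-injective rightPart-into rightPart-avoids)
      where open RootSplit f (suc n) inj into av p p<n fp≡0

module Shapes where
  open import Data.Nat
  open import Data.Nat.Properties
  open import Data.Nat.Combinatorics using (_C_; nCk+nC[k+1]≡[n+1]C[k+1]; nCk≡nC[n∸k])
  open import Data.Nat.Tactic.RingSolver using (solve-∀)
  open import Data.Empty using (⊥-elim)
  open import Data.Product using (_×_; _,_; proj₁; proj₂)
  open import Data.Vec using (Vec; []; _∷_)
  open import Data.List using (List; []; _∷_; map; _++_; length)
  open import Data.List.Properties using (length-++; length-map)
  open import Data.List.Membership.Propositional using (_∈_)
  open import Data.List.Membership.Propositional.Properties using (∈-map⁺; ∈-map⁻; ∈-++⁺ˡ; ∈-++⁺ʳ)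
  open import Data.List.Relation.Unary.Any using (here)
  open import Data.List.Relation.Unary.Unique.Propositional using (Unique)
  import Data.List.Relation.Unary.Unique.Propositional.Properties as Unique
  open import Data.List.Relation.Binary.Disjoint.Propositional using (Disjoint)
  open import Data.List.Relation.Unary.All using (All)
  import Data.List.Relation.Unary.All as All
  import Data.List.Relation.Unary.All.Properties as All
  import Data.List.Relation.Unary.AllPairs as AllPairs
  open import Relation.Binary.PropositionalEquality
  open import Relation.Nullary using (yes; no)
  open TreePermutations using (Tree; leaf; node; size)

  sizes : ∀ {b} → Vec Tree b → ℕ
  sizes [] = 0
  sizes (x ∷ v) = size x + sizes v

  Shape : ℕ → Set
  Shape b = Tree × ℕ × Vec Tree b

  HasSize : ℕ → (b : ℕ) → Shape b → Set
  HasSize m b (t , o , v) = (size t + sizes v ≡ m) × (o ≤ size t)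

  consLeaf : ∀ {b} → Shape b → Shape (suc b)
  consLeaf (t , o , v) = (t , o , leaf ∷ v)

  consNode : ∀ {b} → Shape (suc (suc b)) → Shape (suc b)
  consNode (t , o , x ∷ y ∷ v) = (t , o , node x y ∷ v)

  -- With no extra trees, t = node t₁ t₂ is split at its root: the mark lies
  -- in t₁ …
  markLeft : Shape 1 → Shape 0
  markLeft (t₁ , o , t₂ ∷ []) = (node t₁ t₂ , o , [])

  -- … or in t₂ (the extra tree now being t₁).
  markRight : Shape 1 → Shape 0
  markRight (t₂ , o , t₁ ∷ []) = (node t₁ t₂ , suc (size t₁ + o) , [])

  enumerate : ℕ → (b : ℕ) → List (Shape b)
  enumerate zero    zero    = (leaf , 0 , []) ∷ []
  enumerate zero    (suc b) = map consLeaf (enumerate zero b)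
  enumerate (suc m) zero    = map markLeft (enumerate m 1) ++ map markRight (enumerate m 1)
  enumerate (suc m) (suc b) = map consLeaf (enumerate (suc m) b) ++ map consNode (enumerate m (suc (suc b)))

  enumerate-length : ∀ m b → length (enumerate m b) ≡ (m + m + b) C m
  enumerate-length zero zero = refl
  enumerate-length zero (suc b) = trans (length-map consLeaf (enumerate zero b)) (enumerate-length zero b)
  enumerate-length (suc m) zero = begin
      length (map markLeft (enumerate m 1) ++ map markRight (enumerate m 1))
    ≡⟨ length-++ (map markLeft (enumerate m 1)) ⟩
      length (map markLeft (enumerate m 1)) + length (map markRight (enumerate m 1))
    ≡⟨ cong₂ _+_ (trans (length-map markLeft (enumerate m 1)) (enumerate-length m 1))
                 (trans (length-map markRight (enumerate m 1)) (enumerate-length m 1)) ⟩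
      n C m + n C m
    ≡⟨ cong (n C m +_) symmetry ⟩
      n C m + n C suc m
    ≡⟨ nCk+nC[k+1]≡[n+1]C[k+1] n m ⟩
      suc n C suc m
    ≡⟨ cong (_C suc m) (arith m) ⟩
      (suc m + suc m + 0) C suc m ∎
    where
    open ≡-Reasoning
    n : ℕ
    n = m + m + 1
    n≡ : ∀ m → m + m + 1 ≡ suc m + m
    n≡ = solve-∀
    arith : ∀ m → suc (m + m + 1) ≡ suc m + suc m + 0
    arith = solve-∀
    -- n C m ≡ n C (n ∸ m) with n ∸ m = suc m
    symmetry : n C m ≡ n C suc m
    symmetry = trans (cong (n C_) (sym (trans (cong (_∸ suc m) (n≡ m)) (m+n∸m≡n (suc m) m))))
                     (sym (nCk≡nC[n∸k] (subst (suc m ≤_) (sym (n≡ m)) (m≤m+n (suc m) m))))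
  enumerate-length (suc m) (suc b) = begin
      length (map consLeaf (enumerate (suc m) b) ++ map consNode (enumerate m (suc (suc b))))
    ≡⟨ length-++ (map consLeaf (enumerate (suc m) b)) ⟩
      length (map consLeaf (enumerate (suc m) b)) + length (map consNode (enumerate m (suc (suc b))))
    ≡⟨ cong₂ _+_ (trans (length-map consLeaf (enumerate (suc m) b)) (enumerate-length (suc m) b))
                 (trans (length-map consNode (enumerate m (suc (suc b)))) (enumerate-length m (suc (suc b)))) ⟩
      n C suc m + (m + m + suc (suc b)) C m
    ≡⟨ trans (+-comm (n C suc m) _) (cong (λ x → x C m + n C suc m) (arith₁ m b)) ⟩
      n C m + n C suc m
    ≡⟨ nCk+nC[k+1]≡[n+1]C[k+1] n m ⟩
      suc n C suc m
    ≡⟨ cong (_C suc m) (arith₂ m b) ⟩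
      (suc m + suc m + suc b) C suc m ∎
    where
    open ≡-Reasoning
    n : ℕ
    n = suc m + suc m + b
    arith₁ : ∀ m b → m + m + suc (suc b) ≡ suc m + suc m + b
    arith₁ = solve-∀
    arith₂ : ∀ m b → suc (suc m + suc m + b) ≡ suc m + suc m + suc b
    arith₂ = solve-∀

  private
    split-size : ∀ a b → suc (a + b) + 0 ≡ suc (a + (b + 0))
    split-size = solve-∀
    split-size′ : ∀ a b → suc (a + b) + 0 ≡ suc (b + (a + 0))
    split-size′ = solve-∀
    node-size : ∀ t x y s → t + (suc (x + y) + s) ≡ suc (t + (x + (y + s)))
    node-size = solve-∀

  enumerate-sound : ∀ m b → All (HasSize m b) (enumerate m b)
  enumerate-sound zero zero = (refl , z≤n) All.∷ All.[]
  enumerate-sound zero (suc b) =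
    All.map⁺ (All.map (λ { {_ , _ , _} ok → ok }) (enumerate-sound zero b))
  enumerate-sound (suc m) zero = All.++⁺
    (All.map⁺ (All.map (λ { {t₁ , o , t₂ ∷ []} (sz , o≤) →
       trans (split-size (size t₁) (size t₂)) (cong suc sz) ,
       ≤-trans o≤ (≤-trans (m≤m+n (size t₁) (size t₂)) (n≤1+n _)) }) (enumerate-sound m 1)))
    (All.map⁺ (All.map (λ { {t₂ , o , t₁ ∷ []} (sz , o≤) →
       trans (split-size′ (size t₁) (size t₂)) (cong suc sz) , s≤s (+-monoʳ-≤ (size t₁) o≤) })
       (enumerate-sound m 1)))
  enumerate-sound (suc m) (suc b) = All.++⁺
    (All.map⁺ (All.map (λ { {_ , _ , _} ok → ok }) (enumerate-sound (suc m) b)))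
    (All.map⁺ (All.map (λ { {t , o , y ∷ z ∷ v} (sz , o≤) →
       trans (node-size (size t) (size y) (size z) (sizes v)) (cong suc sz) , o≤ })
       (enumerate-sound m (suc (suc b)))))

  enumerate-complete : ∀ m b x → HasSize m b x → x ∈ enumerate m b
  enumerate-complete zero zero (leaf , zero , []) _ = here refl
  enumerate-complete zero (suc b) (t , o , leaf ∷ v) ok = ∈-map⁺ consLeaf (enumerate-complete zero b (t , o , v) ok)
  enumerate-complete zero (suc b) (t , o , node x y ∷ v) (sz , _) =
    ⊥-elim (1+n≢0 (trans (sym (node-size (size t) (size x) (size y) (sizes v))) sz))
  enumerate-complete (suc m) zero (node t₁ t₂ , o , []) (sz , o≤) with o ≤? size t₁
  ... | yes o≤t₁ = ∈-++⁺ˡ (∈-map⁺ markLeft (enumerate-complete m 1 (t₁ , o , t₂ ∷ [])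
                     (suc-injective (trans (sym (split-size (size t₁) (size t₂))) sz) , o≤t₁)))
  ... | no o≰t₁ = subst (λ z → (node t₁ t₂ , z , []) ∈ enumerate (suc m) zero) (m+[n∸m]≡n t₁<o)
                    (∈-++⁺ʳ (map markLeft (enumerate m 1)) (∈-map⁺ markRight (enumerate-complete m 1
                      (t₂ , o ∸ suc (size t₁) , t₁ ∷ [])
                      (suc-injective (trans (sym (split-size′ (size t₁) (size t₂))) sz) , o′≤))))
    where
    t₁<o : suc (size t₁) ≤ o
    t₁<o = ≰⇒> o≰t₁
    o′≤ : o ∸ suc (size t₁) ≤ size t₂
    o′≤ = subst (o ∸ suc (size t₁) ≤_) (m+n∸m≡n (size t₁) (size t₂)) (∸-monoˡ-≤ (suc (size t₁)) o≤)
  enumerate-complete (suc m) (suc b) (t , o , leaf ∷ v) ok =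
    ∈-++⁺ˡ (∈-map⁺ consLeaf (enumerate-complete (suc m) b (t , o , v) ok))
  enumerate-complete (suc m) (suc b) (t , o , node x y ∷ v) (sz , o≤) =
    ∈-++⁺ʳ (map consLeaf (enumerate (suc m) b)) (∈-map⁺ consNode (enumerate-complete m (suc (suc b)) (t , o , x ∷ y ∷ v)
      (suc-injective (trans (sym (node-size (size t) (size x) (size y) (sizes v))) sz) , o≤)))

  consLeaf-injective : ∀ {b} {x y : Shape b} → consLeaf x ≡ consLeaf y → x ≡ y
  consLeaf-injective {x = _ , _ , _} {_ , _ , _} refl = refl

  consNode-injective : ∀ {b} {x y : Shape (suc (suc b))} → consNode x ≡ consNode y → x ≡ y
  consNode-injective {x = _ , _ , _ ∷ _ ∷ _} {_ , _ , _ ∷ _ ∷ _} refl = refl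

  markLeft-injective : ∀ {x y : Shape 1} → markLeft x ≡ markLeft y → x ≡ y
  markLeft-injective {_ , _ , _ ∷ []} {_ , _ , _ ∷ []} refl = refl

  node-injective : ∀ {a b c d} → node a b ≡ node c d → a ≡ c × b ≡ d
  node-injective refl = refl , refl

  markRight-injective : ∀ {x y : Shape 1} → markRight x ≡ markRight y → x ≡ y
  markRight-injective {t , o , t₁ ∷ []} {_ , o′ , _ ∷ []} e with node-injective (cong proj₁ e)
  ... | refl , refl = cong (λ z → t , z , t₁ ∷ []) (right-mark-injective (cong (λ s → proj₁ (proj₂ s)) e))
    where
    right-mark-injective : suc (size t₁ + o) ≡ suc (size t₁ + o′) → o ≡ o′
    right-mark-injective e = +-cancelˡ-≡ (size t₁) _ _ (suc-injective e)

  markLeft-markRight-disjoint : ∀ m → Disjoint (map markLeft (enumerate m 1)) (map markRight (enumerate m 1))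
  markLeft-markRight-disjoint m (l , r) with ∈-map⁻ markLeft l | ∈-map⁻ markRight r
  ... | (t , o , x ∷ []) , x∈ , e₁ | (t′ , o′ , x′ ∷ []) , _ , e₂ with trans (sym e₁) e₂
  ... | e with node-injective (cong proj₁ e)
  ...   | refl , refl = 1+n≰n (≤-trans (s≤s (m≤m+n (size t) o′))
                          (subst (_≤ size t) (cong (λ s → proj₁ (proj₂ s)) e) (proj₂ (All.lookup (enumerate-sound m 1) x∈))))

  consLeaf-consNode-disjoint : ∀ m b → Disjoint (map consLeaf (enumerate (suc m) b)) (map consNode (enumerate m (suc (suc b))))
  consLeaf-consNode-disjoint m b (l , r) with ∈-map⁻ consLeaf l | ∈-map⁻ consNode r
  ... | (_ , _ , _) , _ , e₁ | (_ , _ , _ ∷ _ ∷ _) , _ , e₂ with trans (sym e₁) e₂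
  ... | ()

  enumerate-unique : ∀ m b → Unique (enumerate m b)
  enumerate-unique zero zero = All.[] AllPairs.∷ AllPairs.[]
  enumerate-unique zero (suc b) = Unique.map⁺ consLeaf-injective (enumerate-unique zero b)
  enumerate-unique (suc m) zero = Unique.++⁺ (Unique.map⁺ markLeft-injective (enumerate-unique m 1))
    (Unique.map⁺ markRight-injective (enumerate-unique m 1)) (markLeft-markRight-disjoint m)
  enumerate-unique (suc m) (suc b) = Unique.++⁺ (Unique.map⁺ consLeaf-injective (enumerate-unique (suc m) b))
    (Unique.map⁺ consNode-injective (enumerate-unique m (suc (suc b)))) (consLeaf-consNode-disjoint m b)

-- Integer sums h 0 + … + h (n-1), defined through the library's finite
-- sums so that its rearrangement lemma applies.
module IntegerSums where
  open import Data.Nat as ℕ using (ℕ; zero; suc)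
  import Data.Nat.Properties as ℕ
  open import Data.Integer hiding (suc)
  open import Data.Integer.Properties
  open import Data.Integer.Tactic.RingSolver using (solve-∀)
  open import Data.Fin using (Fin; toℕ)
  open import Data.Fin.Properties using (toℕ<n)
  open import Data.List using (map; allFin)
  open import Data.List.Properties using (map-tabulate)
  import Algebra.Properties.CommutativeMonoid.Sum +-0-commutativeMonoid as Sum
  open import Relation.Binary.PropositionalEquality
  open import Defs using (sumℤ)
  open TreePermutations using (MapsInto; InjectiveBelow)
  open FiniteMaps using (asPermutation; toℕ-restrict)

  Σ< : (ℕ → ℤ) → ℕ → ℤ
  Σ< h n = Sum.sum (λ (i : Fin n) → h (toℕ i))

  sumℤ-allFin : ∀ n (h : ℕ → ℤ) → sumℤ (map (λ (i : Fin n) → h (toℕ i)) (allFin n)) ≡ Σ< h n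
  sumℤ-allFin n h = trans (cong sumℤ (map-tabulate {n = n} (λ i → i) (λ i → h (toℕ i)))) (go n h)
    where
    go : ∀ n (h : ℕ → ℤ) → sumℤ (Data.List.tabulate {n = n} (λ i → h (toℕ i))) ≡ Σ< h n
    go zero h = refl
    go (suc n) h = cong (λ x → h 0 + x) (go n (λ i → h (suc i)))

  Σ<-cong : ∀ n {h h′ : ℕ → ℤ} → (∀ i → i ℕ.< n → h i ≡ h′ i) → Σ< h n ≡ Σ< h′ n
  Σ<-cong n e = Sum.sum-cong-≗ (λ i → e (toℕ i) (toℕ<n i))

  Σ<-+ : ∀ n (h h′ : ℕ → ℤ) → Σ< (λ i → h i + h′ i) n ≡ Σ< h n + Σ< h′ n
  Σ<-+ n h h′ = Sum.∑-distrib-+ {n} (λ i → h (toℕ i)) (λ i → h′ (toℕ i))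

  Σ<-split : ∀ a b (h : ℕ → ℤ) → Σ< h (a ℕ.+ b) ≡ Σ< h a + Σ< (λ i → h (a ℕ.+ i)) b
  Σ<-split zero b h = sym (+-identityˡ _)
  Σ<-split (suc a) b h = trans (cong (λ x → h 0 + x) (Σ<-split a b (λ i → h (suc i)))) (sym (+-assoc (h 0) _ _))

  Σ<-const : ∀ n c → Σ< (λ _ → c) n ≡ + n * c
  Σ<-const zero c = sym (*-zeroˡ c)
  Σ<-const (suc n) c = trans (cong (λ x → c + x) (Σ<-const n c)) (sym (suc-* (+ n) c))

  permutation-displacement : ∀ n f → InjectiveBelow f n → MapsInto f n → Σ< (λ j → + f j - + j) n ≡ 0ℤ
  permutation-displacement n f inj into = begin
      Σ< (λ j → + f j - + j) n
    ≡⟨ Σ<-+ n (λ j → + f j) (λ j → - + j) ⟩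
      Σ< (λ j → + f j) n + Σ< (λ j → - + j) n
    ≡⟨ cong (_+ Σ< (λ j → - + j) n) rearranged ⟩
      Σ< (λ j → + j) n + Σ< (λ j → - + j) n
    ≡⟨ Σ<-+ n (λ j → + j) (λ j → - + j) ⟨
      Σ< (λ j → + j - + j) n
    ≡⟨ Σ<-cong n (λ j _ → +-inverseʳ (+ j)) ⟩
      Σ< (λ _ → 0ℤ) n
    ≡⟨ trans (Σ<-const n 0ℤ) (*-zeroʳ (+ n)) ⟩
      0ℤ ∎
    where
    open ≡-Reasoning
    rearranged : Σ< (λ j → + f j) n ≡ Σ< (λ j → + j) n
    rearranged = trans (Sum.sum-cong-≗ (λ i → cong +_ (sym (toℕ-restrict f n n into i))))
                       (sym (Sum.sum-permute (λ i → + toℕ i) (asPermutation f n inj into)))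

  -- For a d-periodic h, the sum over the d integers -o,…,d-o-1 equals the
  -- one over 0,…,d-1: the terms at -o,…,-1 are those at d-o,…,d-1.
  periodic-window : ∀ d o (h : ℤ → ℤ) → o ℕ.≤ d → (∀ x → h (x + + d) ≡ h x) →
                    Σ< (λ j → h (- + o + + j)) d ≡ Σ< (λ r → h (+ r)) d
  periodic-window d o h o≤d periodic =
    subst (λ d → Σ< (λ j → h (- + o + + j)) d ≡ Σ< (λ r → h (+ r)) d) (ℕ.m+[n∸m]≡n o≤d)
      (rotate (d ℕ.∸ o) (subst (λ d → ∀ x → h (x + + d) ≡ h x) (sym (ℕ.m+[n∸m]≡n o≤d)) periodic))
    where
    shift₁ : ∀ O S J → - O + J + (O + S) ≡ S + J
    shift₁ = solve-∀
    shift₂ : ∀ O I → - O + (O + I) ≡ I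
    shift₂ = solve-∀
    rotate : ∀ s → (∀ x → h (x + + (o ℕ.+ s)) ≡ h x) →
             Σ< (λ j → h (- + o + + j)) (o ℕ.+ s) ≡ Σ< (λ r → h (+ r)) (o ℕ.+ s)
    rotate s periodic′ = begin
        Σ< (λ j → h (- + o + + j)) (o ℕ.+ s)
      ≡⟨ Σ<-split o s (λ j → h (- + o + + j)) ⟩
        Σ< (λ j → h (- + o + + j)) o + Σ< (λ i → h (- + o + + (o ℕ.+ i))) s
      ≡⟨ cong₂ _+_ (Σ<-cong o (λ j _ → wrap j)) (Σ<-cong s (λ i _ → cong h (unwrap i))) ⟩
        Σ< (λ j → h (+ (s ℕ.+ j))) o + Σ< (λ i → h (+ i)) s
      ≡⟨ +-comm (Σ< (λ j → h (+ (s ℕ.+ j))) o) (Σ< (λ i → h (+ i)) s) ⟩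
        Σ< (λ i → h (+ i)) s + Σ< (λ j → h (+ (s ℕ.+ j))) o
      ≡⟨ Σ<-split s o (λ r → h (+ r)) ⟨
        Σ< (λ r → h (+ r)) (s ℕ.+ o)
      ≡⟨ cong (Σ< (λ r → h (+ r))) (ℕ.+-comm s o) ⟩
        Σ< (λ r → h (+ r)) (o ℕ.+ s) ∎
      where
      open ≡-Reasoning
      wrap : ∀ j → h (- + o + + j) ≡ h (+ (s ℕ.+ j))
      wrap j = trans (sym (periodic′ _)) (cong h (begin
          - + o + + j + + (o ℕ.+ s)  ≡⟨ cong (λ x → - + o + + j + x) (pos-+ o s) ⟩
          - + o + + j + (+ o + + s)  ≡⟨ shift₁ (+ o) (+ s) (+ j) ⟩
          + s + + j                  ≡⟨ pos-+ s j ⟨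
          + (s ℕ.+ j)                ∎))
      unwrap : ∀ i → - + o + + (o ℕ.+ i) ≡ + i
      unwrap i = trans (cong (λ x → - + o + x) (pos-+ o i)) (shift₂ (+ o) (+ i))

module IntegerCancellation where
  open import Data.Integer hiding (suc)
  open import Data.Integer.Properties
  open import Data.Integer.Tactic.RingSolver using (solve-∀)
  open import Relation.Binary.PropositionalEquality

  private
    -a+[a+x] : ∀ a x → - a + (a + x) ≡ x
    -a+[a+x] = solve-∀

  +-cancelˡ-< : ∀ a {x y} → a + x < a + y → x < y
  +-cancelˡ-< a {x} {y} p = subst₂ _<_ (-a+[a+x] a x) (-a+[a+x] a y) (+-monoʳ-< (- a) p)

  +-cancelˡ-≤ : ∀ a {x y} → a + x ≤ a + y → x ≤ y
  +-cancelˡ-≤ a {x} {y} p = subst₂ _≤_ (-a+[a+x] a x) (-a+[a+x] a y) (+-monoʳ-≤ (- a) p)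

  +-cancelˡ-≡ : ∀ a {x y} → a + x ≡ a + y → x ≡ y
  +-cancelˡ-≡ a {x} {y} p = trans (sym (-a+[a+x] a x)) (trans (cong (λ z → - a + z) p) (-a+[a+x] a y))

-- Cutting ℤ into blocks of length d starting at a base point B: every integer
-- is B + (q d + r) with 0 ≤ r < d.  A block map with pattern f maps each
-- block to itself, acting on offsets by f; all the properties of the
-- theorem (bijectivity, periodicity, 312-avoidance, cut points) of a block
-- map reduce to properties of its pattern.
module BlockMaps (d : Nat.ℕ) {{_ : Nat.NonZero d}} where
  open import Data.Nat as ℕ using (ℕ; zero; suc)
  import Data.Nat.Properties as ℕ
  open import Data.Integer hiding (suc)
  open import Data.Integer.Properties
  open import Data.Integer.DivMod using (_/ℕ_; _%ℕ_; a≡a%ℕn+[a/ℕn]*n; n%ℕd<d)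
  open import Data.Integer.Tactic.RingSolver using (solve-∀)
  open import Data.Empty using (⊥-elim)
  open import Data.Product using (Σ; _×_; _,_; proj₁; proj₂)
  open import Data.Sum using (_⊎_; inj₁; inj₂)
  open import Relation.Binary using (tri<; tri≈; tri>)
  open import Relation.Binary.PropositionalEquality
  open import Defs using (Avoids312; IsCutPoint)
  open TreePermutations using (MapsInto; InjectiveBelow; Avoids312Below; CutBelow)
  open FiniteMaps using (surjective)
  open IntegerCancellation

  at : ℤ → ℕ → ℤ
  at q r = q * + d + + r

  at-<-block : ∀ q q′ r r′ → r ℕ.< d → q < q′ → at q r < at q′ r′
  at-<-block q q′ r r′ r<d q<q′ = <-≤-trans (+-monoʳ-< (q * + d) (+<+ r<d)) (begin
      q * + d + + d    ≡⟨ next-block q (+ d) ⟩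
      (1ℤ + q) * + d   ≤⟨ *-monoʳ-≤-nonNeg (+ d) (i<j⇒suc[i]≤j q<q′) ⟩
      q′ * + d         ≤⟨ i≤i++n (q′ * + d) r′ ⟩
      at q′ r′         ∎)
    where
    open ≤-Reasoning
    next-block : ∀ q D → q * D + D ≡ (1ℤ + q) * D
    next-block = solve-∀
    i≤i++n : ∀ i n → i ≤ i + + n
    i≤i++n i n = subst (_≤ i + + n) (+-identityʳ i) (+-monoʳ-≤ i (+≤+ ℕ.z≤n))

  at-<-offset : ∀ q {r r′} → r ℕ.< r′ → at q r < at q r′
  at-<-offset q p = +-monoʳ-< (q * + d) (+<+ p)

  at-<⁻ : ∀ q q′ r r′ → r ℕ.< d → r′ ℕ.< d → at q r < at q′ r′ → q < q′ ⊎ (q ≡ q′ × r ℕ.< r′)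
  at-<⁻ q q′ r r′ r<d r′<d p with <-cmp q q′
  ... | tri< lt _ _ = inj₁ lt
  ... | tri≈ _ refl _ = inj₂ (refl , drop‿+<+ (+-cancelˡ-< (q * + d) p))
  ... | tri> _ _ gt = ⊥-elim (<-asym p (at-<-block q′ q r′ r r′<d gt))

  at-injective : ∀ q q′ r r′ → r ℕ.< d → r′ ℕ.< d → at q r ≡ at q′ r′ → q ≡ q′ × r ≡ r′
  at-injective q q′ r r′ r<d r′<d e with <-cmp q q′
  ... | tri< lt _ _ = ⊥-elim (<-irrefl e (at-<-block q q′ r r′ r<d lt))
  ... | tri≈ _ refl _ = refl , +-injective (+-cancelˡ-≡ (q * + d) e)
  ... | tri> _ _ gt = ⊥-elim (<-irrefl (sym e) (at-<-block q′ q r′ r r′<d gt))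

  at-≤⁻ : ∀ q q′ r r′ → r ℕ.< d → r′ ℕ.< d → at q r ≤ at q′ r′ → q < q′ ⊎ (q ≡ q′ × r ℕ.≤ r′)
  at-≤⁻ q q′ r r′ r<d r′<d p with <-cmp (at q r) (at q′ r′)
  ... | tri< lt _ _ = Data.Sum.map₂ (λ (e , r<r′) → e , ℕ.<⇒≤ r<r′) (at-<⁻ q q′ r r′ r<d r′<d lt)
  ... | tri≈ _ eq _ = let e₁ , e₂ = at-injective q q′ r r′ r<d r′<d eq in inj₂ (e₁ , ℕ.≤-reflexive e₂)
  ... | tri> _ _ gt = ⊥-elim (<-irrefl refl (<-≤-trans gt p))

  coordinates : ∀ B x → Σ ℤ λ q → Σ ℕ λ r → r ℕ.< d × x ≡ B + at q r
  coordinates B x = (x - B) /ℕ d , (x - B) %ℕ d , n%ℕd<d (x - B) d , (begin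
      x                                          ≡⟨ x≡B+[x-B] B x ⟩
      B + (x - B)                                ≡⟨ cong (λ z → B + z) (a≡a%ℕn+[a/ℕn]*n (x - B) d) ⟩
      B + (+ ((x - B) %ℕ d) + (x - B) /ℕ d * + d) ≡⟨ cong (λ z → B + z) (+-comm (+ ((x - B) %ℕ d)) ((x - B) /ℕ d * + d)) ⟩
      B + at ((x - B) /ℕ d) ((x - B) %ℕ d)        ∎)
    where
    open ≡-Reasoning
    x≡B+[x-B] : ∀ B x → x ≡ B + (x - B)
    x≡B+[x-B] = solve-∀

  BlockMap : ℤ → (ℕ → ℕ) → (ℤ → ℤ) → Set
  BlockMap B f π = ∀ q r → r ℕ.< d → π (B + at q r) ≡ B + at q (f r)

  blockMap : ℤ → (ℕ → ℕ) → ℤ → ℤ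
  blockMap B f x = B + at ((x - B) /ℕ d) (f ((x - B) %ℕ d))

  blockMap-isBlockMap : ∀ B f → BlockMap B f (blockMap B f)
  blockMap-isBlockMap B f q r r<d = cong₂ (λ q r → B + at q (f r)) (proj₁ split) (proj₂ split)
    where
    x : ℤ
    x = B + at q r
    B+k-B : ∀ B k → B + k - B ≡ k
    B+k-B = solve-∀
    split : (x - B) /ℕ d ≡ q × (x - B) %ℕ d ≡ r
    split = at-injective _ _ _ _ (n%ℕd<d (x - B) d) r<d (begin
        at ((x - B) /ℕ d) ((x - B) %ℕ d)           ≡⟨ +-comm ((x - B) /ℕ d * + d) (+ ((x - B) %ℕ d)) ⟩
        + ((x - B) %ℕ d) + (x - B) /ℕ d * + d      ≡⟨ a≡a%ℕn+[a/ℕn]*n (x - B) d ⟨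
        x - B                                      ≡⟨ B+k-B B (at q r) ⟩
        at q r                                     ∎)
      where open ≡-Reasoning

  BlockMap-unique : ∀ {B f π π′} → BlockMap B f π → BlockMap B f π′ → ∀ x → π x ≡ π′ x
  BlockMap-unique {B} blk blk′ x with coordinates B x
  ... | q , r , r<d , refl = trans (blk q r r<d) (sym (blk′ q r r<d))

  BlockMap-cong : ∀ {B f f′ π} → (∀ i → i ℕ.< d → f i ≡ f′ i) → BlockMap B f π → BlockMap B f′ π
  BlockMap-cong {B} e blk q r r<d = trans (blk q r r<d) (cong (λ z → B + at q z) (e r r<d))

  -- The pattern of a 312-avoiding block map avoids 312 (look inside block 0).
  pattern-avoids312 : ∀ {B f π} → BlockMap B f π → Avoids312 π → Avoids312Below f d
  pattern-avoids312 {B} {f} blk av i j k i<j j<k k<d fj<fk fk<fi =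
    av (B + at 0ℤ i) (B + at 0ℤ j) (B + at 0ℤ k)
      (+-monoʳ-< B (at-<-offset 0ℤ i<j)) (+-monoʳ-< B (at-<-offset 0ℤ j<k))
      (subst₂ _<_ (sym (blk 0ℤ j j<d)) (sym (blk 0ℤ k k<d)) (+-monoʳ-< B (at-<-offset 0ℤ fj<fk)))
      (subst₂ _<_ (sym (blk 0ℤ k k<d)) (sym (blk 0ℤ i i<d)) (+-monoʳ-< B (at-<-offset 0ℤ fk<fi)))
    where
    j<d : j ℕ.< d
    j<d = ℕ.<-trans j<k k<d
    i<d : i ℕ.< d
    i<d = ℕ.<-trans i<j j<d

  periodic-multiple : (π : ℤ → ℤ) → (∀ x → π (x + + d) ≡ π x + + d) → ∀ x q → π (x + q * + d) ≡ π x + q * + d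
  periodic-multiple π periodic x (+ n) = forward x n
    where
    forward : ∀ x n → π (x + + n * + d) ≡ π x + + n * + d
    forward x zero = trans (cong π (+-identityʳ x)) (sym (+-identityʳ (π x)))
    forward x (suc n) = trans (cong π (next x (+ n) (+ d)))
      (trans (periodic _) (trans (cong (_+ + d) (forward x n)) (sym (next (π x) (+ n) (+ d)))))
      where
      next : ∀ x n D → x + (1ℤ + n) * D ≡ (x + n * D) + D
      next = solve-∀
  periodic-multiple π periodic x -[1+ n ] = begin
      π y                        ≡⟨ cancel (π y) N (+ d) ⟨
      π y + N * + d + - N * + d  ≡⟨ cong (_+ - N * + d) (periodic-multiple π periodic y N) ⟨
      π (y + N * + d) + - N * + d ≡⟨ cong (λ z → π z + - N * + d) (cancel x (- N) (+ d)) ⟩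
      π x + - N * + d            ∎
    where
    open ≡-Reasoning
    N : ℤ
    N = + suc n
    y : ℤ
    y = x + - N * + d
    cancel : ∀ z M D → z + M * D + - M * D ≡ z
    cancel = solve-∀

  periodic-agree : ∀ {π π′ : ℤ → ℤ} → (∀ x → π (x + + d) ≡ π x + + d) → (∀ x → π′ (x + + d) ≡ π′ x + + d) →
                   (∀ r → r ℕ.< d → π (+ r) ≡ π′ (+ r)) → ∀ x → π x ≡ π′ x
  periodic-agree {π} {π′} periodic periodic′ agree x with coordinates 0ℤ x
  ... | q , r , r<d , refl = begin
      π (0ℤ + at q r)    ≡⟨ cong π (regroup q (+ d) (+ r)) ⟩
      π (+ r + q * + d)  ≡⟨ periodic-multiple π periodic (+ r) q ⟩
      π (+ r) + q * + d  ≡⟨ cong (_+ q * + d) (agree r r<d) ⟩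
      π′ (+ r) + q * + d ≡⟨ periodic-multiple π′ periodic′ (+ r) q ⟨
      π′ (+ r + q * + d) ≡⟨ cong π′ (regroup q (+ d) (+ r)) ⟨
      π′ (0ℤ + at q r)   ∎
    where
    open ≡-Reasoning
    regroup : ∀ q D r → 0ℤ + (q * D + r) ≡ r + q * D
    regroup = solve-∀

  module BlockMapProperties {B : ℤ} {f : ℕ → ℕ} {π : ℤ → ℤ}
           (inj : InjectiveBelow f d) (into : MapsInto f d) (blk : BlockMap B f π) where

    injective : ∀ {x y} → π x ≡ π y → x ≡ y
    injective {x} {y} e with coordinates B x | coordinates B y
    ... | q , r , r<d , refl | q′ , r′ , r′<d , refl
      with at-injective q q′ (f r) (f r′) (into r r<d) (into r′ r′<d)
             (+-cancelˡ-≡ B (trans (sym (blk q r r<d)) (trans e (blk q′ r′ r′<d))))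
    ... | refl , fr≡fr′ = cong (λ z → B + at q z) (inj r r′ r<d r′<d fr≡fr′)

    surjective′ : ∀ y → Σ ℤ λ x → π x ≡ y
    surjective′ y with coordinates B y
    ... | q , s , s<d , refl with surjective f d inj into s s<d
    ...   | r , r<d , fr≡s = B + at q r , trans (blk q r r<d) (cong (λ z → B + at q z) fr≡s)

    periodic : ∀ x → π (x + + d) ≡ π x + + d
    periodic x with coordinates B x
    ... | q , r , r<d , refl = begin
        π (B + at q r + + d)         ≡⟨ cong π (next-block B q (+ d) (+ r)) ⟩
        π (B + at (1ℤ + q) r)        ≡⟨ blk (1ℤ + q) r r<d ⟩
        B + at (1ℤ + q) (f r)        ≡⟨ next-block B q (+ d) (+ f r) ⟨
        B + at q (f r) + + d         ≡⟨ cong (_+ + d) (blk q r r<d) ⟨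
        π (B + at q r) + + d         ∎
      where
      open ≡-Reasoning
      next-block : ∀ B q D r → B + (q * D + r) + D ≡ B + ((1ℤ + q) * D + r)
      next-block = solve-∀

    values-<⁻ : ∀ q r q′ r′ → r ℕ.< d → r′ ℕ.< d → π (B + at q r) < π (B + at q′ r′) →
                q < q′ ⊎ (q ≡ q′ × f r ℕ.< f r′)
    values-<⁻ q r q′ r′ r<d r′<d p = at-<⁻ q q′ (f r) (f r′) (into r r<d) (into r′ r′<d)
      (+-cancelˡ-< B (subst₂ _<_ (blk q r r<d) (blk q′ r′ r′<d) p))

    -- A 312 pattern of π must lie in one block, hence is one of f.
    avoids312 : Avoids312Below f d → Avoids312 π
    avoids312 av i j k i<j j<k πj<πk πk<πi with coordinates B i | coordinates B j | coordinates B k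
    ... | qi , ri , ri<d , refl | qj , rj , rj<d , refl | qk , rk , rk<d , refl
      with at-<⁻ qi qj ri rj ri<d rj<d (+-cancelˡ-< B i<j) | at-<⁻ qj qk rj rk rj<d rk<d (+-cancelˡ-< B j<k)
         | values-<⁻ qk rk qi ri rk<d ri<d πk<πi | values-<⁻ qj rj qk rk rj<d rk<d πj<πk
    ... | inj₁ a | inj₁ b | inj₁ c | _ = <-asym (<-trans a b) c
    ... | inj₁ a | inj₂ (refl , _) | inj₁ c | _ = <-asym a c
    ... | inj₂ (refl , _) | inj₁ b | inj₁ c | _ = <-asym b c
    ... | inj₂ (refl , _) | inj₂ (refl , _) | inj₁ c | _ = <-irrefl refl c
    ... | inj₁ a | inj₁ b | inj₂ (refl , _) | _ = <-asym a b
    ... | inj₁ a | inj₂ (refl , _) | inj₂ (refl , _) | _ = <-irrefl refl a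
    ... | inj₂ (refl , _) | inj₁ b | inj₂ (refl , _) | _ = <-irrefl refl b
    ... | inj₂ (refl , a) | inj₂ (refl , b) | inj₂ (_ , c) | inj₁ e = <-irrefl refl e
    ... | inj₂ (refl , a) | inj₂ (refl , b) | inj₂ (_ , c) | inj₂ (_ , e) = av ri rj rk a b rk<d e c

    cut⇐ : ∀ q r → r ℕ.< d → CutBelow f d r → IsCutPoint π (B + at q r)
    cut⇐ q r r<d cut i k i≤ <k with coordinates B i | coordinates B k
    ... | qi , ri , ri<d , refl | qk , rk , rk<d , refl =
      subst₂ _<_ (sym (blk qi ri ri<d)) (sym (blk qk rk rk<d))
        (+-monoʳ-< B (compare (at-≤⁻ qi q ri r ri<d r<d (+-cancelˡ-≤ B i≤))
                              (at-<⁻ q qk r rk r<d rk<d (+-cancelˡ-< B <k))))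
      where
      weaken : ∀ {A : Set} {q q′ : ℤ} → q < q′ ⊎ (q ≡ q′ × A) → q ≤ q′
      weaken (inj₁ lt) = <⇒≤ lt
      weaken (inj₂ (refl , _)) = ≤-refl
      compare : qi < q ⊎ (qi ≡ q × ri ℕ.≤ r) → q < qk ⊎ (q ≡ qk × r ℕ.< rk) → at qi (f ri) < at qk (f rk)
      compare (inj₁ lt) c = at-<-block qi qk (f ri) (f rk) (into ri ri<d) (<-≤-trans lt (weaken c))
      compare (inj₂ (refl , _)) (inj₁ lt) = at-<-block qi qk (f ri) (f rk) (into ri ri<d) lt
      compare (inj₂ (refl , ri≤r)) (inj₂ (refl , r<rk)) = at-<-offset qi (cut ri rk ri≤r r<rk rk<d)

    cut⇒ : ∀ q r → r ℕ.< d → IsCutPoint π (B + at q r) → CutBelow f d r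
    cut⇒ q r r<d cut i j i≤r r<j j<d
      with values-<⁻ q i q j (ℕ.≤-<-trans i≤r (ℕ.<-trans r<j j<d)) j<d
             (cut (B + at q i) (B + at q j) (+-monoʳ-≤ B (+-monoʳ-≤ (q * + d) (+≤+ i≤r)))
                  (+-monoʳ-< B (at-<-offset q r<j)))
    ... | inj₁ q<q = ⊥-elim (<-irrefl refl q<q)
    ... | inj₂ (_ , fi<fj) = fi<fj

-- A block map with base -o and a
-- permutation pattern is balanced; conversely an affine permutation with a
-- cut point at -o-1 is a block map with base -o, the balance condition
-- pinning down the base of the values.
module Normalisation (d : Nat.ℕ) {{_ : Nat.NonZero d}} where
  open import Data.Nat as ℕ using (ℕ; zero; suc)
  import Data.Nat.Properties as ℕ
  open import Data.Integer hiding (suc)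
  open import Data.Integer.Properties
  open import Data.Integer.Tactic.RingSolver using (solve-∀)
  open import Data.Empty using (⊥-elim)
  open import Data.Product using (Σ; _×_; _,_; proj₁; proj₂)
  open import Data.Sum using (_⊎_; inj₁; inj₂)
  open import Relation.Binary.PropositionalEquality
  open import Defs using (IsCutPoint)
  open TreePermutations using (MapsInto; InjectiveBelow)
  open IntegerSums
  open IntegerCancellation
  open BlockMaps d

  displacement-periodic : (π : ℤ → ℤ) → (∀ x → π (x + + d) ≡ π x + + d) →
                          ∀ x → π (x + + d) - (x + + d) ≡ π x - x
  displacement-periodic π periodic x = trans (cong (_- (x + + d)) (periodic x)) (cancel (π x) x (+ d))
    where
    cancel : ∀ a b D → (a + D) - (b + D) ≡ a - b
    cancel = solve-∀

  blockMap-balanced : ∀ {o f π} → o ℕ.≤ d → InjectiveBelow f d → MapsInto f d → BlockMap (- + o) f π →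
                      Σ< (λ r → π (+ r) - + r) d ≡ 0ℤ
  blockMap-balanced {o} {f} {π} o≤d inj into blk = begin
      Σ< (λ r → π (+ r) - + r) d
    ≡⟨ periodic-window d o (λ x → π x - x) o≤d (displacement-periodic π periodic) ⟨
      Σ< (λ j → π (B + + j) - (B + + j)) d
    ≡⟨ Σ<-cong d (λ j j<d → trans (cong (_- (B + + j)) (blk 0ℤ j j<d)) (cancel B (+ f j) (+ j))) ⟩
      Σ< (λ j → + f j - + j) d
    ≡⟨ permutation-displacement d f inj into ⟩
      0ℤ ∎
    where
    open ≡-Reasoning
    open BlockMapProperties {B = - + o} {π = π} inj into blk using (periodic)
    B : ℤ
    B = - + o
    cancel : ∀ B a b → (B + a) - (B + b) ≡ a - b
    cancel = solve-∀

  argmax : ∀ n (h : ℕ → ℤ) → 0 ℕ.< n → Σ ℕ λ j → j ℕ.< n × (∀ i → i ℕ.< n → h i ≤ h j)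
  argmax (suc zero) h _ = 0 , ℕ.z<s , λ { zero _ → ≤-refl ; (suc i) (ℕ.s≤s ()) }
  argmax (suc (suc n)) h _ with argmax (suc n) h ℕ.z<s
  ... | j , j<n , max with ≤-total (h (suc n)) (h j)
  ...   | inj₁ last≤ = j , ℕ.m<n⇒m<1+n j<n , λ i i<n → case i i<n
    where
    case : ∀ i → i ℕ.< suc (suc n) → h i ≤ h j
    case i i<n with ℕ.m<1+n⇒m<n∨m≡n i<n
    ... | inj₁ i<n′ = max i i<n′
    ... | inj₂ refl = last≤
  ...   | inj₂ ≤last = suc n , ℕ.≤-refl , λ i i<n → case i i<n
    where
    case : ∀ i → i ℕ.< suc (suc n) → h i ≤ h (suc n)
    case i i<n with ℕ.m<1+n⇒m<n∨m≡n i<n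
    ... | inj₁ i<n′ = ≤-trans (max i i<n′) ≤last
    ... | inj₂ refl = ≤-refl

  cut-shift : ∀ {π} → (∀ x → π (x + + d) ≡ π x + + d) → ∀ x → IsCutPoint π x → IsCutPoint π (x - + d)
  cut-shift {π} periodic x cut i k i≤ <k = +-cancelʳ-< (subst₂ _<_ (periodic i) (periodic k)
      (cut (i + + d) (k + + d) (subst (i + + d ≤_) (back x) (+-monoˡ-≤ (+ d) i≤))
                               (subst (_< k + + d) (back x) (+-monoˡ-< (+ d) <k))))
    where
    back′ : ∀ x D → x - D + D ≡ x
    back′ = solve-∀
    back : ∀ x → x - + d + + d ≡ x
    back x = back′ x (+ d)
    +-cancelʳ-< : ∀ {a b} → a + + d < b + + d → a < b
    +-cancelʳ-< {a} {b} p = +-cancelˡ-< (+ d) (subst₂ _<_ (+-comm a (+ d)) (+-comm b (+ d)) p)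

  module Normalise (o : ℕ) (o≤d : o ℕ.≤ d) (π : ℤ → ℤ)
                   (π-injective : ∀ {x y} → π x ≡ π y → x ≡ y)
                   (periodic : ∀ x → π (x + + d) ≡ π x + + d)
                   (balanced : Σ< (λ r → π (+ r) - + r) d ≡ 0ℤ)
                   (cut : IsCutPoint π (- + o - 1ℤ)) where
    B : ℤ
    B = - + o

    value : ℕ → ℤ
    value j = π (B + + j)

    private
      max : Σ ℕ λ j → j ℕ.< d × (∀ i → i ℕ.< d → value i ≤ value j)
      max = argmax d value (ℕ.n≢0⇒n>0 (ℕ.≢-nonZero⁻¹ d))
    jₘ : ℕ
    jₘ = proj₁ max
    jₘ<d : jₘ ℕ.< d
    jₘ<d = proj₁ (proj₂ max)
    M : ℤ
    M = value jₘ
    value≤M : ∀ j → j ℕ.< d → value j ≤ M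
    value≤M = proj₂ (proj₂ max)

    -- M - d is the value at B + jₘ - d ≤ B - 1, left of the cut, hence
    -- smaller than every value in the window: all values lie in [L, L + d).
    L : ℤ
    L = M - + d + 1ℤ

    L≤value : ∀ j → j ℕ.< d → L ≤ value j
    L≤value j j<d = subst (_≤ value j) (+-comm 1ℤ (M - + d)) (i<j⇒suc[i]≤j (begin-strict
        M - + d                ≡⟨ shift (π (B + + jₘ - + d)) (+ d) M (trans (cong π (sym (back (B + + jₘ) (+ d)))) (periodic _)) ⟩
        π (B + + jₘ - + d)     <⟨ cut _ _ left-of-cut (+-monoʳ-< B -<+) ⟩
        value j                ∎))
      where
      open ≤-Reasoning
      back : ∀ x D → x - D + D ≡ x
      back = solve-∀
      shift : ∀ y D m → m ≡ y + D → m - D ≡ y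
      shift y D m e = trans (cong (_- D) e) (cancel y D)
        where
        cancel : ∀ y D → y + D - D ≡ y
        cancel = solve-∀
      -- B + jₘ - d = (B - 1) + (1 + jₘ - d) with 1 + jₘ ≤ d
      left-of-cut : B + + jₘ - + d ≤ B - 1ℤ
      left-of-cut = subst₂ _≤_ (sym (regroup B (+ jₘ) (+ d))) (+-identityʳ (B - 1ℤ))
        (+-monoʳ-≤ (B - 1ℤ) (i≤j⇒i-j≤0 (subst (_≤ + d) (pos-+ 1 jₘ) (+≤+ jₘ<d))))
        where
        regroup : ∀ B j D → B + j - D ≡ (B - 1ℤ) + ((1ℤ + j) - D)
        regroup = solve-∀

    g : ℕ → ℕ
    g j = ∣ value j - L ∣

    g≡value-L : ∀ j → j ℕ.< d → + g j ≡ value j - L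
    g≡value-L j j<d = 0≤i⇒+∣i∣≡i (i≤j⇒0≤j-i (L≤value j j<d))

    value≡L+g : ∀ j → j ℕ.< d → value j ≡ L + + g j
    value≡L+g j j<d = trans (split (value j) L) (cong (λ z → L + z) (sym (g≡value-L j j<d)))
      where
      split : ∀ v L → v ≡ L + (v - L)
      split = solve-∀

    g-into : MapsInto g d
    g-into j j<d = drop‿+<+ (begin-strict
        + g j          ≡⟨ g≡value-L j j<d ⟩
        value j - L    ≤⟨ +-monoˡ-≤ (- L) (value≤M j j<d) ⟩
        M - L          ≡⟨ width M (+ d) ⟩
        + d - 1ℤ       <⟨ subst (+ d - 1ℤ <_) (+-identityʳ (+ d)) (+-monoʳ-< (+ d) -<+) ⟩
        + d            ∎)
      where
      open ≤-Reasoning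
      width : ∀ M D → M - (M - D + 1ℤ) ≡ D - 1ℤ
      width = solve-∀

    g-injective : InjectiveBelow g d
    g-injective i j i<d j<d e = +-injective (+-cancelˡ-≡ B (π-injective (begin
        value i      ≡⟨ value≡L+g i i<d ⟩
        L + + g i    ≡⟨ cong (λ z → L + + z) e ⟩
        L + + g j    ≡⟨ value≡L+g j j<d ⟨
        value j      ∎)))
      where open ≡-Reasoning

    -- The total displacement over the window is d (L - B); it vanishes by
    -- balance, so L = B.
    window-displacement : Σ< (λ j → π (B + + j) - (B + + j)) d ≡ + d * (L - B)
    window-displacement = begin
        Σ< (λ j → π (B + + j) - (B + + j)) d
      ≡⟨ Σ<-cong d (λ j j<d → trans (cong (_- (B + + j)) (value≡L+g j j<d)) (regroup L (+ g j) B (+ j))) ⟩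
        Σ< (λ j → (L - B) + (+ g j - + j)) d
      ≡⟨ Σ<-+ d (λ _ → L - B) (λ j → + g j - + j) ⟩
        Σ< (λ _ → L - B) d + Σ< (λ j → + g j - + j) d
      ≡⟨ cong₂ _+_ (Σ<-const d (L - B)) (permutation-displacement d g g-injective g-into) ⟩
        + d * (L - B) + 0ℤ
      ≡⟨ +-identityʳ _ ⟩
        + d * (L - B) ∎
      where
      open ≡-Reasoning
      regroup : ∀ L g B j → (L + g) - (B + j) ≡ (L - B) + (g - j)
      regroup = solve-∀

    L≡B : L ≡ B
    L≡B = from-product (i*j≡0⇒i≡0∨j≡0 (+ d) product≡0)
      where
      open ≡-Reasoning
      product≡0 : + d * (L - B) ≡ 0ℤ
      product≡0 = begin
        + d * (L - B)                           ≡⟨ window-displacement ⟨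
        Σ< (λ j → π (B + + j) - (B + + j)) d    ≡⟨ periodic-window d o (λ x → π x - x) o≤d (displacement-periodic π periodic) ⟩
        Σ< (λ r → π (+ r) - + r) d              ≡⟨ balanced ⟩
        0ℤ                                      ∎
      split : ∀ L B → L ≡ (L - B) + B
      split = solve-∀
      from-product : + d ≡ 0ℤ ⊎ L - B ≡ 0ℤ → L ≡ B
      from-product (inj₁ d≡0) = ⊥-elim (ℕ.≢-nonZero⁻¹ d (+-injective d≡0))
      from-product (inj₂ L-B≡0) = trans (split L B) (trans (cong (_+ B) L-B≡0) (+-identityˡ B))

    isBlockMap : BlockMap B g π
    isBlockMap q r r<d = begin
        π (B + at q r)                ≡⟨ cong π (regroup B q (+ d) (+ r)) ⟩
        π (B + + r + q * + d)         ≡⟨ periodic-multiple π periodic (B + + r) q ⟩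
        value r + q * + d             ≡⟨ cong (_+ q * + d) (trans (value≡L+g r r<d) (cong (_+ + g r) L≡B)) ⟩
        B + + g r + q * + d           ≡⟨ regroup B q (+ d) (+ g r) ⟨
        B + at q (g r)                ∎
      where
      open ≡-Reasoning
      regroup : ∀ B q D r → B + (q * D + r) ≡ (B + r) + q * D
      regroup = solve-∀

module Counting where
  open import Data.Nat
  open import Data.Nat.Properties
  open import Data.Bool using (Bool; true; false)
  open import Data.Empty using (⊥-elim)
  open import Data.Product using (Σ; _×_; _,_)
  open import Data.Fin using (Fin; toℕ)
  import Data.Fin as Fin
  open import Data.Fin.Subset using (Subset; ∣_∣) renaming (_∈_ to _∈ₛ_)
  open import Data.Vec using (_∷_; []; here; there; tabulate; lookup)
  open import Data.Vec.Properties using (lookup∘tabulate; tabulate∘lookup; tabulate-cong; []=⇒lookup; lookup⇒[]=)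
  open import Function.Bundles using (_⇔_; mk⇔; Equivalence)
  open import Relation.Nullary using (yes; no)
  open import Relation.Binary.PropositionalEquality

  indicator : Bool → ℕ
  indicator true = 1
  indicator false = 0

  count : (ℕ → Bool) → ℕ → ℕ
  count P zero = 0
  count P (suc n) = indicator (P 0) + count (λ i → P (suc i)) n

  count-split : ∀ a b P → count P (a + b) ≡ count P a + count (λ i → P (a + i)) b
  count-split zero b P = refl
  count-split (suc a) b P = trans (cong (indicator (P 0) +_) (count-split a b (λ i → P (suc i))))
                                  (sym (+-assoc (indicator (P 0)) _ _))

  count-cong : ∀ n {P Q} → (∀ i → i < n → P i ≡ Q i) → count P n ≡ count Q n
  count-cong zero e = refl
  count-cong (suc n) e = cong₂ _+_ (cong indicator (e 0 z<s)) (count-cong n (λ i p → e (suc i) (s≤s p)))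

  count-none : ∀ n P → (∀ i → i < n → P i ≡ false) → count P n ≡ 0
  count-none n P e = trans (count-cong n e) (none n)
    where
    none : ∀ n → count (λ _ → false) n ≡ 0
    none zero = refl
    none (suc n) = none n

  ∣tabulate∣ : ∀ n (P : ℕ → Bool) → ∣ tabulate {n = n} (λ r → P (toℕ r)) ∣ ≡ count P n
  ∣tabulate∣ zero P = refl
  ∣tabulate∣ (suc n) P with P 0
  ... | true = cong suc (∣tabulate∣ n (λ i → P (suc i)))
  ... | false = ∣tabulate∣ n (λ i → P (suc i))

  ∈-tabulate : ∀ {n} (P : Fin n → Bool) r → (r ∈ₛ tabulate P) ⇔ (P r ≡ true)
  ∈-tabulate P r = mk⇔ (λ r∈ → trans (sym (lookup∘tabulate P r)) ([]=⇒lookup r∈))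
                       (λ e → lookup⇒[]= r _ (trans (lookup∘tabulate P r) e))

  characterised : ∀ {n} (S : Subset n) (P : Fin n → Bool) → (∀ r → (r ∈ₛ S) ⇔ (P r ≡ true)) → S ≡ tabulate P
  characterised S P h = trans (sym (tabulate∘lookup S)) (tabulate-cong λ r → bool-ext (lookup S r) (P r)
    (λ e → Equivalence.to (h r) (lookup⇒[]= r S e)) (λ e → []=⇒lookup (Equivalence.from (h r) e)))
    where
    bool-ext : ∀ x y → (x ≡ true → y ≡ true) → (y ≡ true → x ≡ true) → x ≡ y
    bool-ext true _ to _ = sym (to refl)
    bool-ext false true _ from = from refl
    bool-ext false false _ _ = refl

  maximum : ∀ {n} (S : Subset n) → 0 < ∣ S ∣ → Σ (Fin n) λ c → c ∈ₛ S × (∀ r → r ∈ₛ S → toℕ r ≤ toℕ c)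
  maximum [] ()
  maximum (x ∷ S) pos with 0 <? ∣ S ∣
  ... | yes p with maximum S p
  ...   | c , c∈S , max = Fin.suc c , there c∈S , λ { Fin.zero _ → z≤n ; (Fin.suc r) (there q) → s≤s (max r q) }
  maximum (true ∷ S) pos | no p = Fin.zero , here , λ { Fin.zero _ → z≤n ; (Fin.suc r) (there q) → ⊥-elim (p (nonempty S r q)) }
    where
    nonempty : ∀ {n} (S : Subset n) (r : Fin n) → r ∈ₛ S → 0 < ∣ S ∣
    nonempty (true ∷ S) Fin.zero here = z<s
    nonempty (true ∷ S) (Fin.suc r) (there q) = z<s
    nonempty (false ∷ S) (Fin.suc r) (there q) = nonempty S r q
  maximum (false ∷ S) pos | no p = ⊥-elim (p pos)

module RightSpine where
  open import Data.Nat
  open import Data.Nat.Properties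
  open import Data.Nat.Tactic.RingSolver using (solve-∀)
  open import Data.Bool using (Bool; true; false)
  open import Data.Empty using (⊥-elim)
  open import Data.Product using (_,_)
  open import Data.Vec using (Vec; []; _∷_)
  open import Relation.Binary.PropositionalEquality
  open TreePermutations
  open Counting using (count; count-split; count-cong; count-none; indicator)
  open Shapes using (sizes; node-injective)

  comb : ∀ {b} → Vec Tree b → Tree
  comb [] = leaf
  comb (x ∷ v) = node x (comb v)

  spineLength : Tree → ℕ
  spineLength leaf = 0
  spineLength (node _ r) = suc (spineLength r)

  spineTrees : (R : Tree) → Vec Tree (spineLength R)
  spineTrees leaf = []
  spineTrees (node a r) = a ∷ spineTrees r

  comb-spineTrees : ∀ R → comb (spineTrees R) ≡ R
  comb-spineTrees leaf = refl
  comb-spineTrees (node a r) = cong (node a) (comb-spineTrees r)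

  spineLength-comb : ∀ {b} (v : Vec Tree b) → spineLength (comb v) ≡ b
  spineLength-comb [] = refl
  spineLength-comb (x ∷ v) = cong suc (spineLength-comb v)

  size-comb : ∀ {b} (v : Vec Tree b) → size (comb v) ≡ b + sizes v
  size-comb [] = refl
  size-comb {suc b} (x ∷ v) = trans (cong (λ z → suc (size x + z)) (size-comb v)) (shuffle (size x) b (sizes v))
    where
    shuffle : ∀ x b s → suc (x + (b + s)) ≡ suc b + (x + s)
    shuffle = solve-∀

  comb-injective : ∀ {b} (v v′ : Vec Tree b) → comb v ≡ comb v′ → v ≡ v′
  comb-injective [] [] _ = refl
  comb-injective (x ∷ v) (x′ ∷ v′) e with node-injective e
  ... | refl , e′ = cong (x ∷_) (comb-injective v v′ e′)

  onSpine-bounded : ∀ T x → onSpine T x ≡ true → x < size T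
  onSpine-bounded leaf x ()
  onSpine-bounded (node a b) x e with side (size a) x
  ... | inLeft p = <-trans p (s≤s (m≤m+n _ _))
  ... | atRoot = s≤s (m≤m+n _ _)
  ... | inRight j = s≤s (+-monoʳ-< (size a) (onSpine-bounded b j (trans (sym (onSpine-right a b j)) e)))

  onSpine-last : ∀ a b → onSpine (node a b) (size a + size b) ≡ true
  onSpine-last a leaf = trans (cong (onSpine (node a leaf)) (+-identityʳ (size a))) (onSpine-root a leaf)
  onSpine-last a (node c e) = trans (cong (onSpine (node a (node c e))) (+-suc (size a) (size c + size e)))
                                (trans (onSpine-right a (node c e) _) (onSpine-last c e))

  count-onSpine : ∀ T → count (onSpine T) (size T) ≡ spineLength T
  count-onSpine leaf = refl
  count-onSpine (node a b) = begin
      count S (suc (size a + size b))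
    ≡⟨ cong (count S) (sym (+-suc (size a) (size b))) ⟩
      count S (size a + suc (size b))
    ≡⟨ count-split (size a) (suc (size b)) S ⟩
      count S (size a) + (indicator (S (size a + 0)) + count (λ i → S (size a + suc i)) (size b))
    ≡⟨ cong₂ _+_ (count-none (size a) S (onSpine-left a b))
         (cong₂ _+_ (cong indicator (trans (cong S (+-identityʳ (size a))) (onSpine-root a b)))
           (count-cong (size b) (λ i _ → trans (cong S (+-suc (size a) i)) (onSpine-right a b i)))) ⟩
      1 + count (onSpine b) (size b)
    ≡⟨ cong suc (count-onSpine b) ⟩
      spineLength (node a b) ∎
    where
    open ≡-Reasoning
    S : ℕ → Bool
    S = onSpine (node a b)

  count-onSpine-from : ∀ T o → (∀ i → i < o → onSpine T i ≡ false) →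
                       count (λ r → onSpine T (r + o)) (size T) ≡ spineLength T
  count-onSpine-from T o below = begin
      count (λ r → S (r + o)) n
    ≡⟨ count-cong n (λ r _ → cong S (+-comm r o)) ⟩
      count (λ r → S (o + r)) n
    ≡⟨ cong (_+ count (λ r → S (o + r)) n) (count-none o S below) ⟨
      count S o + count (λ r → S (o + r)) n
    ≡⟨ count-split o n S ⟨
      count S (o + n)
    ≡⟨ trans (cong (count S) (+-comm o n)) (count-split n o S) ⟩
      count S n + count (λ i → S (n + i)) o
    ≡⟨ cong (count S n +_) (count-none o _ (λ i _ → beyond i)) ⟩
      count S n + 0
    ≡⟨ trans (+-identityʳ _) (count-onSpine T) ⟩
      spineLength T ∎
    where
    open ≡-Reasoning
    S : ℕ → Bool
    S = onSpine T
    n : ℕ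
    n = size T
    beyond : ∀ i → S (n + i) ≡ false
    beyond i with S (n + i) in eq
    ... | false = refl
    ... | true = ⊥-elim (<-irrefl refl (≤-<-trans (m≤m+n n i) (onSpine-bounded T (n + i) eq)))

module ListFacts where
  open import Data.List using (List; []; _∷_; map)
  open import Data.List.Membership.Propositional using (_∈_)
  open import Data.List.Relation.Unary.Any using (here; there)
  import Data.List.Relation.Unary.All as All
  import Data.List.Relation.Unary.All.Properties as All
  open import Data.List.Relation.Unary.AllPairs using ([]; _∷_)
  open import Data.List.Relation.Unary.Unique.Propositional using (Unique)
  open import Relation.Binary.PropositionalEquality

  unique-map : ∀ {A B : Set} (f : A → B) (xs : List A) → Unique xs →
               (∀ x y → x ∈ xs → y ∈ xs → f x ≡ f y → x ≡ y) → Unique (map f xs)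
  unique-map f [] _ _ = []
  unique-map f (x ∷ xs) (x∉ ∷ u) inj =
    All.map⁺ (All.tabulate (λ {y} y∈ e → All.lookup x∉ y∈ (inj x y (here refl) (there y∈) e)))
    ∷ unique-map f xs u (λ y z y∈ z∈ → inj y z (there y∈) (there z∈))

module Windows (b m : Nat.ℕ) where
  open import Data.Nat as ℕ using (ℕ; zero; suc)
  import Data.Nat.Properties as ℕ
  open import Data.Integer hiding (suc; ∣_∣)
  open import Data.Integer.Properties
  open import Data.Integer.Tactic.RingSolver using (solve-∀)
  open import Data.Bool using (true; false)
  open import Data.Empty using (⊥-elim)
  open import Data.Product using (Σ; _×_; _,_; proj₁; proj₂)
  open import Data.Fin using (Fin; toℕ; fromℕ<)
  open import Data.Fin.Properties using (toℕ<n; toℕ-fromℕ<)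
  open import Data.Fin.Subset using (Subset; ∣_∣) renaming (_∈_ to _∈ₛ_)
  open import Data.Vec using (Vec; lookup; tabulate)
  open import Data.Vec.Properties using (lookup∘tabulate; tabulate∘lookup; tabulate-cong)
  open import Function.Bundles using (_⇔_; mk⇔; Equivalence)
  open import Relation.Nullary using (yes; no)
  open import Data.Nat.Tactic.RingSolver renaming (solve-∀ to ℕ-solve-∀)
  open import Data.Nat.Combinatorics using (_C_; nCk≡nC[n∸k])
  open import Data.List using (List; map; length)
  open import Data.List.Properties using (length-map)
  open import Data.List.Membership.Propositional using (_∈_)
  open import Data.List.Membership.Propositional.Properties using (∈-map⁺; ∈-map⁻)
  import Data.List.Relation.Unary.All as All
  open import Data.List.Relation.Unary.Unique.Propositional using (Unique)
  open import Relation.Binary.PropositionalEquality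
  open import Defs
  open ListFacts using (unique-map)
  open TreePermutations
  open Shapes
  open RightSpine
  open Counting

  d : ℕ
  d = suc (b ℕ.+ m)

  k : ℕ
  k = suc b

  open BlockMaps d
  open Normalisation d

  -- Cut points of a block map with base -o whose pattern is the permutation
  -- of a tree node t R with o ≤ size t: the residue r is a cut point exactly
  -- when position r + o is on the spine (positions wrapping around past d
  -- land in t, off the spine).
  module SpineCuts (t R : Tree) (o : ℕ) (size≡d : size (node t R) ≡ d) (o≤t : o ℕ.≤ size t)
                   (π : ℤ → ℤ) (blk : BlockMap (- + o) (perm (node t R)) π) where
    T : Tree
    T = node t R
    B : ℤ
    B = - + o

    pattern-injective : InjectiveBelow (perm T) d
    pattern-injective = subst (InjectiveBelow (perm T)) size≡d (perm-injective T)

    pattern-into : MapsInto (perm T) d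
    pattern-into = subst (MapsInto (perm T)) size≡d (perm-into T)

    open BlockMapProperties {B = B} {π = π} pattern-injective pattern-into blk using (cut⇐; cut⇒)

    cutBelow⇒spine : ∀ j → j ℕ.< d → CutBelow (perm T) d j → onSpine T j ≡ true
    cutBelow⇒spine j j<d c = cut⇒spine T j (subst (j ℕ.<_) (sym size≡d) j<d) (subst (λ n → CutBelow (perm T) n j) (sym size≡d) c)

    spine⇒cutBelow : ∀ j → onSpine T j ≡ true → CutBelow (perm T) d j
    spine⇒cutBelow j e = subst (λ n → CutBelow (perm T) n j) size≡d (spine⇒cut T j e)

    cut⇔spine : ∀ r → r ℕ.< d → IsCutPoint π (+ r) ⇔ (onSpine T (r ℕ.+ o) ≡ true)
    cut⇔spine r r<d with r ℕ.+ o ℕ.<? d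
    ... | yes r+o<d = mk⇔
      (λ c → cutBelow⇒spine _ r+o<d (cut⇒ 0ℤ (r ℕ.+ o) r+o<d (subst (IsCutPoint π) position c)))
      (λ e → subst (IsCutPoint π) (sym position) (cut⇐ 0ℤ (r ℕ.+ o) r+o<d (spine⇒cutBelow _ e)))
      where
      -- r lies in block 0 at offset r + o
      position : + r ≡ B + at 0ℤ (r ℕ.+ o)
      position = trans (shift (+ o) (+ r)) (cong (λ z → B + z) (sym (pos-+ r o)))
        where
        shift : ∀ o r → r ≡ - o + (r + o)
        shift = solve-∀
    ... | no r+o≮d = mk⇔
      (λ c → ⊥-elim (false≢true (trans (sym (onSpine-left t R j (ℕ.<-≤-trans j<o o≤t)))
               (cutBelow⇒spine j j<d (cut⇒ 1ℤ j j<d (subst (IsCutPoint π) position c))))))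
      (λ e → ⊥-elim (r+o≮d (subst (r ℕ.+ o ℕ.<_) size≡d (onSpine-bounded T (r ℕ.+ o) e))))
      where
      -- r lies in block 1 at offset j = r + o - d < o
      j : ℕ
      j = r ℕ.+ o ℕ.∸ d
      d+j : d ℕ.+ j ≡ r ℕ.+ o
      d+j = ℕ.m+[n∸m]≡n (ℕ.≮⇒≥ r+o≮d)
      j<o : j ℕ.< o
      j<o = ℕ.+-cancelˡ-< d j o (subst (ℕ._< d ℕ.+ o) (sym d+j) (ℕ.+-monoˡ-< o r<d))
      j<d : j ℕ.< d
      j<d = ℕ.<-trans j<o (ℕ.≤-<-trans o≤t (subst (size t ℕ.<_) size≡d (ℕ.s≤s (ℕ.m≤m+n _ _))))
      position : + r ≡ B + at 1ℤ j
      position = trans (shift (+ o) (+ r)) (cong (λ z → B + z)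
        (trans (sym (pos-+ r o)) (trans (cong +_ (sym d+j)) (trans (pos-+ d j) (one-block (+ d) (+ j))))))
        where
        shift : ∀ o r → r ≡ - o + (r + o)
        shift = solve-∀
        one-block : ∀ D j → D + j ≡ 1ℤ * D + j
        one-block = solve-∀
      false≢true : false ≢ true
      false≢true ()

  affineOf : Shape b → ℤ → ℤ
  affineOf (t , o , v) = blockMap (- + o) (perm (node t (comb v)))

  window : Shape b → Vec ℤ d
  window x = tabulate (λ r → affineOf x (toℤ r))

  size-treeOf : ∀ t (v : Vec Tree b) → size t ℕ.+ sizes v ≡ m → size (node t (comb v)) ≡ d
  size-treeOf t v e = cong suc (trans (cong (size t ℕ.+_) (size-comb v))
    (trans (ℕ.+-comm (size t) (b ℕ.+ sizes v)) (trans (ℕ.+-assoc b (sizes v) (size t))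
      (cong (b ℕ.+_) (trans (ℕ.+-comm (sizes v) (size t)) e)))))

  cutResidues : Tree → ℕ → Subset d
  cutResidues T o = tabulate (λ r → onSpine T (toℕ r ℕ.+ o))

  ∣cutResidues∣ : ∀ t R o → size (node t R) ≡ d → o ℕ.≤ size t → ∣ cutResidues (node t R) o ∣ ≡ suc (spineLength R)
  ∣cutResidues∣ t R o size≡d o≤t = begin
      ∣ cutResidues T o ∣
    ≡⟨ ∣tabulate∣ d (λ r → onSpine T (r ℕ.+ o)) ⟩
      count (λ r → onSpine T (r ℕ.+ o)) d
    ≡⟨ cong (count (λ r → onSpine T (r ℕ.+ o))) (sym size≡d) ⟩
      count (λ r → onSpine T (r ℕ.+ o)) (size T)
    ≡⟨ count-onSpine-from T o (λ i i<o → onSpine-left t R i (ℕ.<-≤-trans i<o o≤t)) ⟩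
      spineLength T ∎
    where
    open ≡-Reasoning
    T : Tree
    T = node t R

  window-good : ∀ x → HasSize m b x → GoodWindow d k (window x)
  window-good (t , o , v) (size≡m , o≤t) =
    π , (λ r → sym (lookup∘tabulate (λ r → π (toℤ r)) r)) , affine , avoids312 pattern-avoids ,
    (cutResidues T o , cardinality , membership)
    where
    T : Tree
    T = node t (comb v)
    π : ℤ → ℤ
    π = blockMap (- + o) (perm T)
    blk : BlockMap (- + o) (perm T) π
    blk = blockMap-isBlockMap (- + o) (perm T)
    size≡d : size T ≡ d
    size≡d = size-treeOf t v size≡m
    open SpineCuts t (comb v) o size≡d o≤t π blk using (pattern-injective; pattern-into; cut⇔spine)
    open BlockMapProperties {B = - + o} {π = π} pattern-injective pattern-into blk
    pattern-avoids : Avoids312Below (perm T) d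
    pattern-avoids = subst (Avoids312Below (perm T)) size≡d (perm-avoids312 T)
    o≤d : o ℕ.≤ d
    o≤d = ℕ.≤-trans o≤t (ℕ.≤-trans (ℕ.m≤m+n (size t) _) (ℕ.≤-trans (ℕ.n≤1+n _) (ℕ.≤-reflexive size≡d)))
    affine : IsAffinePerm d π
    affine = record
      { bijective = (λ {x} {y} → injective) , (λ y → proj₁ (surjective′ y) , λ { refl → proj₂ (surjective′ y) })
      ; periodic = periodic
      ; balanced = trans (IntegerSums.sumℤ-allFin d (λ i → π (+ i) - + i))
                         (blockMap-balanced {π = π} o≤d pattern-injective pattern-into blk)
      }
    cardinality : ∣ cutResidues T o ∣ ≡ k
    cardinality = trans (∣cutResidues∣ t (comb v) o size≡d o≤t) (cong suc (spineLength-comb v))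
    membership : ∀ r → (r ∈ₛ cutResidues T o) ⇔ IsCutPoint π (toℤ r)
    membership r = mk⇔
      (λ r∈ → Equivalence.from (cut⇔spine (toℕ r) (toℕ<n r)) (Equivalence.to (∈-tabulate (λ r → onSpine T (toℕ r ℕ.+ o)) r) r∈))
      (λ c → Equivalence.from (∈-tabulate (λ r → onSpine T (toℕ r ℕ.+ o)) r) (Equivalence.to (cut⇔spine (toℕ r) (toℕ<n r)) c))

  module OfShape (t : Tree) (o : ℕ) (v : Vec Tree b) (ok : HasSize m b (t , o , v)) where
    T : Tree
    T = node t (comb v)
    π : ℤ → ℤ
    π = affineOf (t , o , v)
    blk : BlockMap (- + o) (perm T) π
    blk = blockMap-isBlockMap (- + o) (perm T)
    size≡d : size T ≡ d
    size≡d = size-treeOf t v (proj₁ ok)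
    o≤t : o ℕ.≤ size t
    o≤t = proj₂ ok
    open SpineCuts t (comb v) o size≡d o≤t π blk public using (cut⇔spine; pattern-into)
    open BlockMapProperties {B = - + o} {π = π} (SpineCuts.pattern-injective t (comb v) o size≡d o≤t π blk) pattern-into blk
      public using (periodic)

    o<d : o ℕ.< d
    o<d = ℕ.≤-<-trans o≤t (ℕ.≤-trans (ℕ.s≤s (ℕ.m≤m+n (size t) _)) (ℕ.≤-reflexive size≡d))

    -- the residue of the last spine position d - 1
    lastCut : ℕ
    lastCut = d ℕ.∸ suc o

    lastCut+o : suc (lastCut ℕ.+ o) ≡ d
    lastCut+o = trans (sym (ℕ.+-suc lastCut o)) (ℕ.m∸n+n≡m o<d)

    lastCut<d : lastCut ℕ.< d
    lastCut<d = ℕ.≤-<-trans (ℕ.m∸n≤m (b ℕ.+ m) o) (ℕ.n<1+n (b ℕ.+ m))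

    lastCut-isCut : IsCutPoint π (+ lastCut)
    lastCut-isCut = Equivalence.from (cut⇔spine lastCut lastCut<d)
      (trans (cong (onSpine T) (ℕ.suc-injective (trans lastCut+o (sym size≡d)))) (onSpine-last t (comb v)))

  cut-transfer : ∀ {π π′} → (∀ z → π z ≡ π′ z) → ∀ y → IsCutPoint π y → IsCutPoint π′ y
  cut-transfer e y cut i k i≤ <k = subst₂ _<_ (e i) (e k) (cut i k i≤ <k)

  -- If two shapes give the same permutation, the last cut of the first is a
  -- cut of the second, which bounds the mark of the second.
  mark-bound : ∀ t o v ok t′ o′ v′ ok′ → (∀ z → affineOf (t , o , v) z ≡ affineOf (t′ , o′ , v′) z) → o′ ℕ.≤ o
  mark-bound t o v ok t′ o′ v′ ok′ same = ℕ.+-cancelˡ-≤ X.lastCut o′ o (ℕ.≤-pred (begin-strict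
      X.lastCut ℕ.+ o′   <⟨ subst (X.lastCut ℕ.+ o′ ℕ.<_) Y.size≡d (onSpine-bounded Y.T _ on-Y-spine) ⟩
      d                  ≡⟨ X.lastCut+o ⟨
      suc (X.lastCut ℕ.+ o) ∎))
    where
    module X = OfShape t o v ok
    module Y = OfShape t′ o′ v′ ok′
    open ℕ.≤-Reasoning
    on-Y-spine : onSpine Y.T (X.lastCut ℕ.+ o′) ≡ true
    on-Y-spine = Equivalence.to (Y.cut⇔spine X.lastCut X.lastCut<d) (cut-transfer same _ X.lastCut-isCut)

  affineOf-injective : ∀ t o v ok t′ o′ v′ ok′ → (∀ z → affineOf (t , o , v) z ≡ affineOf (t′ , o′ , v′) z) →
                       (t , o , v) ≡ (t′ , o′ , v′)
  affineOf-injective t o v ok t′ o′ v′ ok′ same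
    with ℕ.≤-antisym (mark-bound t′ o′ v′ ok′ t o v ok (λ z → sym (same z))) (mark-bound t o v ok t′ o′ v′ ok′ same)
  ... | refl with node-injective (perm-determines X.T Y.T (trans X.size≡d (sym Y.size≡d)) same-pattern)
    where
    module X = OfShape t o v ok
    module Y = OfShape t′ o v′ ok′
    same-pattern : ∀ j → j ℕ.< size X.T → perm X.T j ≡ perm Y.T j
    same-pattern j j<size = proj₂ (at-injective 0ℤ 0ℤ _ _ (X.pattern-into j j<d) (Y.pattern-into j j<d)
      (IntegerCancellation.+-cancelˡ-≡ (- + o) (trans (sym (X.blk 0ℤ j j<d)) (trans (same (- + o + at 0ℤ j)) (Y.blk 0ℤ j j<d)))))
      where
      j<d = subst (j ℕ.<_) X.size≡d j<size
  ... | refl , same-comb = cong (λ v → t , o , v) (comb-injective v v′ same-comb)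

  window-injective : ∀ x y → HasSize m b x → HasSize m b y → window x ≡ window y → x ≡ y
  window-injective (t , o , v) (t′ , o′ , v′) ok ok′ e = affineOf-injective t o v ok t′ o′ v′ ok′
    (periodic-agree X.periodic Y.periodic λ r r<d → begin
      X.π (+ r)                              ≡⟨ cong (λ i → X.π (+ i)) (toℕ-fromℕ< r<d) ⟨
      X.π (toℤ (fromℕ< r<d))                 ≡⟨ lookup∘tabulate (λ r → X.π (toℤ r)) (fromℕ< r<d) ⟨
      lookup (window (t , o , v)) (fromℕ< r<d)    ≡⟨ cong (λ w → lookup w (fromℕ< r<d)) e ⟩
      lookup (window (t′ , o′ , v′)) (fromℕ< r<d) ≡⟨ lookup∘tabulate (λ r → Y.π (toℤ r)) (fromℕ< r<d) ⟩
      Y.π (toℤ (fromℕ< r<d))                 ≡⟨ cong (λ i → Y.π (+ i)) (toℕ-fromℕ< r<d) ⟩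
      Y.π (+ r)                              ∎)
    where
    open ≡-Reasoning
    module X = OfShape t o v ok
    module Y = OfShape t′ o′ v′ ok′

  module Reconstruct (π : ℤ → ℤ) (affine : IsAffinePerm d π) (av : Avoids312 π)
                     (S : Subset d) (card : ∣ S ∣ ≡ k) (memb : ∀ r → (r ∈ₛ S) ⇔ IsCutPoint π (toℤ r)) where
    open IsAffinePerm affine using (periodic; balanced)

    -- the largest cut residue c; the mark will be o = d - 1 - c
    private
      largest : Σ (Fin d) λ c → c ∈ₛ S × (∀ r → r ∈ₛ S → toℕ r ℕ.≤ toℕ c)
      largest = maximum S (subst (0 ℕ.<_) (sym card) ℕ.z<s)
    c : Fin d
    c = proj₁ largest
    c-max : ∀ r → r ∈ₛ S → toℕ r ℕ.≤ toℕ c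
    c-max = proj₂ (proj₂ largest)

    o : ℕ
    o = d ℕ.∸ suc (toℕ c)

    o+c : o ℕ.+ suc (toℕ c) ≡ d
    o+c = ℕ.m∸n+n≡m (toℕ<n c)

    B : ℤ
    B = - + o

    -- c - d = B - 1 is a cut point, so π is a block map with base B
    cut-before-window : IsCutPoint π (B - 1ℤ)
    cut-before-window = subst (IsCutPoint π) c-d≡B-1
      (cut-shift periodic (+ toℕ c) (Equivalence.to (memb c) (proj₁ (proj₂ largest))))
      where
      rearrange : ∀ c o → c - (o + (1ℤ + c)) ≡ - o - 1ℤ
      rearrange = solve-∀
      c-d≡B-1 : + toℕ c - + d ≡ B - 1ℤ
      c-d≡B-1 = trans (cong (λ z → + toℕ c - z) (trans (cong +_ (sym o+c))
                  (trans (pos-+ o (suc (toℕ c))) (cong (λ z → + o + z) (pos-+ 1 (toℕ c))))))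
                  (rearrange (+ toℕ c) (+ o))

    open Normalise o (ℕ.m∸n≤m d (suc (toℕ c))) π (proj₁ (IsAffinePerm.bijective affine)) periodic
      (trans (sym (IntegerSums.sumℤ-allFin d (λ i → π (+ i) - + i))) balanced) cut-before-window
      using (g; g-injective; g-into; isBlockMap)

    tree : TreeDecomposition.TreeOf g d
    tree = TreeDecomposition.decompose d g g-injective g-into (pattern-avoids312 {B = B} {π = π} isBlockMap av)

    module FromTree (t R : Tree) (size≡d : size (node t R) ≡ d) (agree : ∀ i → i ℕ.< d → g i ≡ perm (node t R) i) where
      T : Tree
      T = node t R

      blk : BlockMap B (perm T) π
      blk = BlockMap-cong {B = B} {π = π} agree isBlockMap

      -- if o > size t, the root of T (at residue c + 1 + size t) would be
      -- a cut residue beyond the largest one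
      o≤t : o ℕ.≤ size t
      o≤t = ℕ.≮⇒≥ λ t<o → ℕ.<-irrefl refl (ℕ.<-≤-trans (ℕ.s≤s (ℕ.m≤m+n (toℕ c) (size t)))
              (subst (ℕ._≤ toℕ c) (toℕ-fromℕ< (r<d t<o)) (c-max _ (root-cut t<o))))
        where
        r : ℕ
        r = suc (toℕ c) ℕ.+ size t
        r<d : size t ℕ.< o → r ℕ.< d
        r<d t<o = subst (r ℕ.<_) (trans (ℕ.+-comm (suc (toℕ c)) o) o+c) (ℕ.+-monoʳ-< (suc (toℕ c)) t<o)
        root-cut : (t<o : size t ℕ.< o) → fromℕ< (r<d t<o) ∈ₛ S
        root-cut t<o = Equivalence.from (memb _) (subst (IsCutPoint π) position
            (cut⇐ 1ℤ (size t) t<d (subst (λ n → CutBelow (perm T) n (size t)) size≡d (spine⇒cut T (size t) (onSpine-root t R)))))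
          where
          t<d : size t ℕ.< d
          t<d = ℕ.<-trans t<o (subst (o ℕ.<_) o+c (ℕ.m<m+n o ℕ.z<s))
          open BlockMapProperties {B = B} {π = π} (subst (InjectiveBelow (perm T)) size≡d (perm-injective T))
                                  (subst (MapsInto (perm T)) size≡d (perm-into T)) blk using (cut⇐)
          cᶻ : ℤ
          cᶻ = + toℕ c
          d≡ : + d ≡ + o + (1ℤ + cᶻ)
          d≡ = trans (cong +_ (sym o+c)) (trans (pos-+ o (suc (toℕ c))) (cong (λ z → + o + z) (pos-+ 1 (toℕ c))))
          rearrange : ∀ o cᶻ s → - o + (1ℤ * (o + (1ℤ + cᶻ)) + s) ≡ (1ℤ + cᶻ) + s
          rearrange = solve-∀
          position : B + at 1ℤ (size t) ≡ toℤ (fromℕ< (r<d t<o))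
          position = begin
              - + o + (1ℤ * + d + + size t)             ≡⟨ cong (λ D → - + o + (1ℤ * D + + size t)) d≡ ⟩
              - + o + (1ℤ * (+ o + (1ℤ + cᶻ)) + + size t) ≡⟨ rearrange (+ o) cᶻ (+ size t) ⟩
              (1ℤ + cᶻ) + + size t                       ≡⟨ cong (_+ + size t) (pos-+ 1 (toℕ c)) ⟨
              + suc (toℕ c) + + size t                   ≡⟨ pos-+ (suc (toℕ c)) (size t) ⟨
              + r                                       ≡⟨ cong +_ (toℕ-fromℕ< (r<d t<o)) ⟨
              toℤ (fromℕ< (r<d t<o))                    ∎
            where open ≡-Reasoning

      cut-residues : S ≡ cutResidues T o
      cut-residues = characterised S (λ r → onSpine T (toℕ r ℕ.+ o)) λ r → mk⇔
        (λ r∈ → Equivalence.to (cut⇔spine (toℕ r) (toℕ<n r)) (Equivalence.to (memb r) r∈))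
        (λ e → Equivalence.from (memb r) (Equivalence.from (cut⇔spine (toℕ r) (toℕ<n r)) e))
        where open SpineCuts t R o size≡d o≤t π blk using (cut⇔spine)

      spineLength-R : spineLength R ≡ b
      spineLength-R = ℕ.suc-injective (begin
        suc (spineLength R)        ≡⟨ ∣cutResidues∣ t R o size≡d o≤t ⟨
        ∣ cutResidues T o ∣        ≡⟨ cong ∣_∣ cut-residues ⟨
        ∣ S ∣                      ≡⟨ card ⟩
        k                          ∎)
        where open ≡-Reasoning

      v : Vec Tree b
      v = subst (Vec Tree) spineLength-R (spineTrees R)

      comb-v : comb v ≡ R
      comb-v = trans (comb-subst spineLength-R (spineTrees R)) (comb-spineTrees R)
        where
        comb-subst : ∀ {a a′} (e : a ≡ a′) (u : Vec Tree a) → comb (subst (Vec Tree) e u) ≡ comb u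
        comb-subst refl u = refl

      hasSize : HasSize m b (t , o , v)
      hasSize = ℕ.+-cancelˡ-≡ b _ _ (begin
          b ℕ.+ (size t ℕ.+ sizes v)     ≡⟨ swap b (size t) (sizes v) ⟩
          size t ℕ.+ (b ℕ.+ sizes v)     ≡⟨ cong (size t ℕ.+_) (trans (sym (size-comb v)) (cong size comb-v)) ⟩
          size t ℕ.+ size R              ≡⟨ ℕ.suc-injective size≡d ⟩
          b ℕ.+ m                        ∎) , o≤t
        where
        open ≡-Reasoning
        swap : ∀ a b s → a ℕ.+ (b ℕ.+ s) ≡ b ℕ.+ (a ℕ.+ s)
        swap a b s = trans (sym (ℕ.+-assoc a b s)) (trans (cong (ℕ._+ s) (ℕ.+-comm a b)) (ℕ.+-assoc b a s))

      is-affineOf : ∀ z → π z ≡ affineOf (t , o , v) z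
      is-affineOf z = trans (BlockMap-unique {B} {perm T} {π} blk (blockMap-isBlockMap B (perm T)) z)
                            (cong (λ R → blockMap B (perm (node t R)) z) (sym comb-v))

  window-complete : ∀ w → GoodWindow d k w → Σ (Shape b) λ x → HasSize m b x × w ≡ window x
  window-complete w (π , agrees , affine , av , S , card , memb) = from-tree tree
    where
    open Reconstruct π affine av S card memb using (tree; module FromTree)
    from-tree : TreeDecomposition.TreeOf _ d → Σ (Shape b) λ x → HasSize m b x × w ≡ window x
    from-tree (leaf , () , _)
    from-tree (node t R , size≡d , agree) = (t , o , v) , hasSize , (begin
        w                                            ≡⟨ tabulate∘lookup w ⟨
        tabulate (lookup w)                          ≡⟨ tabulate-cong (λ r → trans (sym (agrees r)) (is-affineOf (toℤ r))) ⟩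
        window (t , o , v)                           ∎)
      where
      open ≡-Reasoning
      open Reconstruct π affine av S card memb using (o)
      open FromTree t R size≡d agree using (v; hasSize; is-affineOf)

  windows : List (Vec ℤ d)
  windows = map window (enumerate m b)

  windows-unique : Unique windows
  windows-unique = unique-map window (enumerate m b) (enumerate-unique m b) λ x y x∈ y∈ →
    window-injective x y (All.lookup (enumerate-sound m b) x∈) (All.lookup (enumerate-sound m b) y∈)

  windows-good : ∀ w → (w ∈ windows) ⇔ GoodWindow d k w
  windows-good w = mk⇔ (λ w∈ → to (∈-map⁻ window w∈)) (λ good → from (window-complete w good))
    where
    to : (Σ (Shape b) λ x → x ∈ enumerate m b × w ≡ window x) → GoodWindow d k w
    to (x , x∈ , w≡) = subst (GoodWindow d k) (sym w≡) (window-good x (All.lookup (enumerate-sound m b) x∈))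
    from : (Σ (Shape b) λ x → HasSize m b x × w ≡ window x) → w ∈ windows
    from (x , ok , w≡) = subst (_∈ windows) (sym w≡) (∈-map⁺ window (enumerate-complete m b x ok))

  windows-length : length windows ≡ (2 ℕ.* d ℕ.∸ k ℕ.∸ 1) C (d ℕ.∸ 1)
  windows-length = begin
      length windows                  ≡⟨ length-map window (enumerate m b) ⟩
      length (enumerate m b)          ≡⟨ enumerate-length m b ⟩
      n C m                           ≡⟨ nCk≡nC[n∸k] (subst (m ℕ.≤_) (sym (n≡ m b)) (ℕ.m≤m+n m (b ℕ.+ m))) ⟩
      n C (n ℕ.∸ m)                   ≡⟨ cong (n C_) (trans (cong (ℕ._∸ m) (n≡ m b)) (ℕ.m+n∸m≡n m (b ℕ.+ m))) ⟩
      n C (b ℕ.+ m)                   ≡⟨ cong (_C (b ℕ.+ m)) twice-d ⟨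
      (2 ℕ.* d ℕ.∸ k ℕ.∸ 1) C (d ℕ.∸ 1) ∎
    where
    open ≡-Reasoning
    n : ℕ
    n = m ℕ.+ m ℕ.+ b
    n≡ : ∀ m b → m ℕ.+ m ℕ.+ b ≡ m ℕ.+ (b ℕ.+ m)
    n≡ = ℕ-solve-∀
    double : ∀ b m → 2 ℕ.* suc (b ℕ.+ m) ≡ suc b ℕ.+ suc (m ℕ.+ m ℕ.+ b)
    double = ℕ-solve-∀
    twice-d : 2 ℕ.* d ℕ.∸ k ℕ.∸ 1 ≡ n
    twice-d = trans (cong (λ z → z ℕ.∸ k ℕ.∸ 1) (double b m)) (cong (ℕ._∸ 1) (ℕ.m+n∸m≡n (suc b) (suc n)))

  enumeration : Σ (List (Vec ℤ d)) λ L → Unique L × (∀ w → (w ∈ L) ⇔ GoodWindow d k w)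
                  × (length L ≡ (2 ℕ.* d ℕ.∸ k ℕ.∸ 1) C (d ℕ.∸ 1))
  enumeration = windows , windows-unique , windows-good , windows-length

open import Defs
open import Data.Nat using (ℕ; _≤_; _*_; _∸_; zero; suc)
open import Data.Nat.Properties using (m+[n∸m]≡n)
open import Data.Nat.Combinatorics using (_C_)
open import Data.Integer using (ℤ)
open import Data.Vec using (Vec)
open import Data.List using (List; length)
open import Data.List.Membership.Propositional using (_∈_)
open import Data.List.Relation.Unary.Unique.Propositional using (Unique)
open import Data.Product using (Σ; _×_)
open import Function.Bundles using (_⇔_)
open import Relation.Binary.PropositionalEquality using (_≡_; subst)

Enumeration : ℕ → ℕ → Set
Enumeration d k = Σ (List (Vec ℤ d)) λ L → Unique L
  × (∀ w → (w ∈ L) ⇔ GoodWindow d k w)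
  × (length L ≡ (2 * d ∸ k ∸ 1) C (d ∸ 1))

theorem4p2 : (d k : ℕ) → 1 ≤ k → k ≤ d →
    Σ (List (Vec ℤ d)) λ L → Unique L
    × (∀ w → (w ∈ L) ⇔ GoodWindow d k w)
    × (length L ≡ (2 * d ∸ k ∸ 1) C (d ∸ 1))
theorem4p2 d zero () _
theorem4p2 d (suc b) _ k≤d =
  subst (λ d → Enumeration d (suc b)) (m+[n∸m]≡n k≤d) (Windows.enumeration b (d ∸ suc b))
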